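{- Let $\lambda$ be a partition with $n$ parts, and let $\{f_\eta\}_{\eta\in S_\lambda}$ and $\{g_\eta\}_{\eta\in S_\lambda}$ be two KZ families. If the ratio $h:=g_\lambda/f_\lambda$ is symmetric in $x_1,\dots,x_n$, then $g_\eta/f_\eta=h$ for all $\eta\in S_\lambda$.
   Context: $S_\lambda$ is the set of compositions rearranging $\lambda$; $s_i\eta$ swaps entries $i,i+1$ of $\eta$. For $f\in\mathbb{Q}(t)[x_1,\dots,x_n]$ and $1\le i\le n-1$, $s_if$ swaps $x_i,x_{i+1}$ and $T_if=tf-\frac{tx_i-x_{i+1}}{x_i-x_{i+1}}(f-s_if)$. A KZ family is a family $\{f_\eta\}_{\eta\in S_\lambda}$ of homogeneous degree-$|\lambda|$ polynomials in $x_1,\dots,x_n$ with coefficients rational in $t$ such that for all $\eta$ and $i$: $T_if_\eta=f_{s_i\eta}$ when $\eta_i>\eta_{i+1}$; $T_if_\eta=tf_\eta$ when $\eta_i=\eta_{i+1}$; and $f_\eta(x_1,\dots,x_n)=f_{(\eta_n,\eta_1,\dots,\eta_{n-1})}(x_n,x_1,\dots,x_{n-1})$. -}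

module Defs where

open import Data.Nat using (ℕ; zero; suc; _≤_)
import Data.Nat as ℕ
open import Data.Rational using (ℚ; 0ℚ; 1ℚ) renaming (_+_ to _+ℚ_; _*_ to _*ℚ_; -_ to -ℚ_)
open import Data.Fin using (Fin; toℕ) renaming (_≟_ to _≟F_)
import Data.Fin as Fin
open import Data.Fin.Permutation using (Permutation′; _⟨$⟩ʳ_)
open import Data.Vec using (Vec; []; _∷_; lookup; tabulate; replicate; _[_]≔_; zipWith; last; init; _∷ʳ_; head; tail)
import Data.Vec as Vec
open import Data.Vec.Properties using (≡-dec)
open import Data.List using (List; []; _∷_; _++_; map; concatMap; foldr)
open import Data.Product using (_×_; _,_; proj₁; proj₂; Σ; ∃)
open import Relation.Nullary using (¬_; yes; no)
open import Relation.Binary.PropositionalEquality using (_≡_; _≢_)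

-- An exponent vector has length suc n: position 0 is the exponent of t,
-- position (suc i) is the exponent of x_(i+1).

Mon : ℕ → Set
Mon n = Vec ℕ (suc n)

Poly : ℕ → Set
Poly n = List (ℚ × Mon n)

coeff : ∀ {n} → Poly n → Mon n → ℚ
coeff []             α = 0ℚ
coeff ((q , β) ∷ p) α with ≡-dec ℕ._≟_ β α
... | yes _ = q +ℚ coeff p α
... | no  _ = coeff p α

infix 4 _≈ₚ_
_≈ₚ_ : ∀ {n} → Poly n → Poly n → Set
p ≈ₚ q = ∀ α → coeff p α ≡ coeff q α

NonZeroP : ∀ {n} → Poly n → Set
NonZeroP p = ¬ (∀ α → coeff p α ≡ 0ℚ)

infixl 6 _+ₚ_ _-ₚ_
infixl 7 _*ₚ_

_+ₚ_ : ∀ {n} → Poly n → Poly n → Poly n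
p +ₚ q = p ++ q

-ₚ_ : ∀ {n} → Poly n → Poly n
-ₚ p = map (λ { (q , α) → (-ℚ q , α) }) p

_-ₚ_ : ∀ {n} → Poly n → Poly n → Poly n
p -ₚ q = p +ₚ (-ₚ q)

_*ₚ_ : ∀ {n} → Poly n → Poly n → Poly n
p *ₚ q = concatMap (λ { (a , α) → map (λ { (b , β) → (a *ℚ b , zipWith ℕ._+_ α β) }) q }) p

tP : ∀ {n} → Poly n
tP {n} = (1ℚ , (1 ∷ replicate n 0)) ∷ []

xP : ∀ {n} → Fin n → Poly n
xP {n} i = (1ℚ , (0 ∷ (replicate n 0 [ i ]≔ 1))) ∷ []

onX : ∀ {n} → (Vec ℕ n → Vec ℕ n) → Poly n → Poly n
onX φ p = map (λ { (q , α) → (q , (head α ∷ φ (tail α))) }) p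

xdeg : ∀ {n} → Mon n → ℕ
xdeg α = Vec.sum (tail α)

swapFin : ∀ {n} → Fin n → Fin n → Fin n → Fin n
swapFin i j k with k ≟F i
... | yes _ = j
... | no _ with k ≟F j
...   | yes _ = i
...   | no _  = k

swapV : ∀ {A : Set} {n} → Fin n → Fin n → Vec A n → Vec A n
swapV i j v = tabulate (λ k → lookup v (swapFin i j k))

rotR : ∀ {A : Set} {n} → Vec A n → Vec A n
rotR []       = []
rotR (x ∷ xs) = last (x ∷ xs) ∷ init (x ∷ xs)

rotL : ∀ {A : Set} {n} → Vec A n → Vec A n
rotL []       = []
rotL (x ∷ xs) = xs ∷ʳ x

permV : ∀ {A : Set} {n} → Permutation′ n → Vec A n → Vec A n
permV σ v = tabulate (λ k → lookup v (σ ⟨$⟩ʳ k))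

Adj : ∀ {n} → Fin n → Fin n → Set
Adj i j = toℕ j ≡ suc (toℕ i)

IsPartition : ∀ {n} → Vec ℕ n → Set
IsPartition {n} λ' = ∀ (i j : Fin n) → toℕ i ≤ toℕ j → lookup λ' j ≤ lookup λ' i

_∈S_ : ∀ {n} → Vec ℕ n → Vec ℕ n → Set
_∈S_ {n} η λ' = Σ (Permutation′ n) (λ σ → η ≡ permV σ λ')

-- Polynomials in x₁,…,xₙ with coefficients in ℚ(t):
-- a fraction P / d with P ∈ ℚ[t,x] and d ∈ ℚ[t] nonzero.

record Frac (n : ℕ) : Set where
  field
    num    : Poly n
    den    : Poly n
    den-t  : ∀ α → coeff den α ≢ 0ℚ → tail α ≡ replicate n 0
    den-nz : NonZeroP den
open Frac public

infix 4 _≈_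
_≈_ : ∀ {n} → Frac n → Frac n → Set
f ≈ g = num f *ₚ den g ≈ₚ num g *ₚ den f

NonZeroF : ∀ {n} → Frac n → Set
NonZeroF f = NonZeroP (num f)

Homog : ∀ {n} → ℕ → Frac n → Set
Homog k f = ∀ α → coeff (num f) α ≢ 0ℚ → xdeg α ≡ k

substF : ∀ {n} → (Vec ℕ n → Vec ℕ n) → Frac n → Frac n
substF φ f = record f { num = onX φ (num f) }

sF : ∀ {n} → Fin n → Fin n → Frac n → Frac n
sF i j = substF (swapV i j)

tF : ∀ {n} → Frac n → Frac n
tF f = record f { num = tP *ₚ num f }

-- Hecke operator, as a relation "T_i f = g":
--   T_i f = t f - (t x_i - x_{i+1}) (f - s_i f) / (x_i - x_{i+1}),
-- written with the (exact) division cleared and the denominators d, e of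
-- f = P/d, g = Q/e multiplied out:
--   (x_i - x_{i+1}) (t P e - Q d) = (t x_i - x_{i+1}) (P - s_i P) e.
TRel : ∀ {n} → Fin n → Fin n → Frac n → Frac n → Set
TRel i j f g =
  (xP i -ₚ xP j) *ₚ ((tP *ₚ num f *ₚ den g) -ₚ (num g *ₚ den f))
    ≈ₚ ((tP *ₚ xP i) -ₚ xP j) *ₚ (num f -ₚ onX (swapV i j) (num f)) *ₚ den g

-- KZ family indexed by compositions (values outside S_λ are irrelevant)
record KZFamily {n} (λ' : Vec ℕ n) (F : Vec ℕ n → Frac n) : Set where
  field
    homog : ∀ η → η ∈S λ' → Homog (Vec.sum λ') (F η)
    T-gt  : ∀ η → η ∈S λ' → ∀ (i j : Fin n) → Adj i j →
            lookup η j Data.Nat.< lookup η i → TRel i j (F η) (F (swapV i j η))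
    T-eq  : ∀ η → η ∈S λ' → ∀ (i j : Fin n) → Adj i j →
            lookup η i ≡ lookup η j → TRel i j (F η) (tF (F η))
    cyc   : ∀ η → η ∈S λ' → F η ≈ substF rotL (F (rotR η))

-- ratio g/f as a pair (numerator, denominator) in ℚ[t,x]:
-- (Q/e)/(P/d) = (Q d)/(P e)
ratioN : ∀ {n} → Frac n → Frac n → Poly n
ratioN g f = num g *ₚ den f

ratioD : ∀ {n} → Frac n → Frac n → Poly n
ratioD g f = num f *ₚ den g

SymRat : ∀ {n} → Poly n → Poly n → Set
SymRat {n} N D = ∀ (σ : Permutation′ n) → onX (permV σ) N *ₚ D ≈ₚ N *ₚ onX (permV σ) D

EqRat : ∀ {n} → Poly n → Poly n → Poly n → Poly n → Set
EqRat N D N' D' = N *ₚ D' ≈ₚ N' *ₚ D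

-- Every η ∈ S_λ other than λ has an ascent η_i < η_{i+1}; swapping it lowers Σ_k k·η_k, and
-- λ is the only weakly decreasing rearrangement of λ.  So every η is reached from λ by steps
-- μ ↦ s_i μ with μ_i > μ_{i+1}, along which f_{s_i μ} = T_i f_μ and g_{s_i μ} = T_i g_μ (these are
-- the only relations of a KZ family that are needed).  T_i commutes with multiplication by the
-- s_i-invariant h, so g_μ = h f_μ propagates to g_{s_i μ} = h f_{s_i μ}; and T_i is injective, so
-- f_{s_i μ} ≠ 0.  The computation takes place in ℚ[t, x₁, …, xₙ] after clearing denominators,
-- which lie in ℚ[t] and are therefore s_i-invariant; ℚ[t, x₁, …, xₙ] has no zero divisors by the
-- leading-monomial argument.

module Submission where

open import Defs hiding (_≈_)
open import Algebra.Bundles using (CommutativeMonoid; CommutativeRing)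
import Algebra.Properties.CommutativeSemigroup
import Algebra.Definitions as AlgebraDefinitions
open import Algebra.Morphism.Structures using (module RingMorphisms)
open import Algebra.Structures using (IsCommutativeRing)
open import Data.Fin as Fin using (Fin; zero; suc) renaming (_≟_ to _≟ᶠ_)
import Data.Fin.Properties as Fin
open import Data.Fin.Permutation using (Permutation′; _⟨$⟩ʳ_; _⟨$⟩ˡ_; inverseʳ; flip; transpose; _∘ₚ_)
open import Data.Integer as ℤ using (ℤ; +_; -[1+_]; _⊖_; sign; ∣_∣)
import Data.Integer.Properties as ℤₚ
open import Data.List using (List; []; _∷_; _++_; map; concatMap; deduplicate)
import Data.List.Properties as List
open import Data.List.Membership.Propositional using (_∈_)
open import Data.List.Membership.Propositional.Properties using (∈-++⁺ˡ; ∈-++⁺ʳ; ∈-deduplicate⁺)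
import Data.List.Relation.Unary.All as All
open import Data.List.Relation.Unary.AllPairs using (_∷_)
open import Data.List.Relation.Unary.Any using (here; there)
open import Data.List.Relation.Unary.Unique.Propositional using (Unique)
open import Data.List.Relation.Unary.Unique.DecPropositional.Properties using (deduplicate-!)
open import Data.Maybe using (Maybe; just; nothing)
open import Data.Nat as ℕ using (ℕ; _<_; _≤_; z≤n; s≤s)
import Data.Nat.Properties as ℕ
open import Data.Nat.Induction using (<-wellFounded)
open import Data.Product using (_×_; _,_; proj₁; proj₂; ∃; ∃₂)
open import Data.Rational using (ℚ; 0ℚ; 1ℚ; 1/_; ≢-nonZero) renaming (_+_ to _+ℚ_; _*_ to _*ℚ_; -_ to -ℚ_)
import Data.Rational.Properties as ℚ
open import Data.Sign as Sign using (Sign)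
open import Data.Sum using (_⊎_; inj₁; inj₂)
open import Data.Vec using (Vec; []; _∷_; head; tail; lookup; tabulate; replicate; zipWith; sum; _[_]≔_)
import Data.Vec.Properties as Vec
import Data.Vec.Relation.Binary.Lex.Strict as Lex
open import Data.Vec.Relation.Binary.Pointwise.Extensional using (ext; Pointwise-≡⇒≡)
import Data.Vec.Relation.Binary.Pointwise.Inductive as Pointwise
open import Function using (_on_; Inverse)
open import Function.Consequences.Propositional using (inverseʳ⇒injective)
open import Induction.WellFounded using (Acc; acc)
open import Level using (_⊔_)
open import Relation.Binary.Bundles using (StrictTotalOrder)
import Relation.Binary.Construct.On as On
open import Relation.Binary.Definitions using (Trichotomous; tri<; tri≈; tri>)
open import Relation.Binary.PropositionalEquality using (_≡_; _≢_; refl; sym; trans; cong; cong₂; subst; subst₂; ≢-sym; module ≡-Reasoning)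
open import Relation.Nullary using (¬_; yes; no; contradiction)

-- The standard library's ring solver needs coefficients with a (weakly) decidable
-- equality; the integers, mapped into R along the canonical morphism, provide them.
module IntegerCoefficients {c ℓ} (R : CommutativeRing c ℓ) where

  open CommutativeRing R renaming (refl to ≈-refl; sym to ≈-sym; trans to ≈-trans; reflexive to ≈-reflexive)
  open import Algebra.Properties.Semiring.Mult semiring using (×-homo-+; ×1-homo-*) renaming (_×_ to _×ₙ_)
  open import Algebra.Properties.Ring ring using (-‿distribˡ-*; -0#≈0#; -‿involutive)
  open import Algebra.Properties.AbelianGroup +-abelianGroup using (⁻¹-∙-comm)
  import Algebra.Solver.CommutativeMonoid as CommutativeMonoidSolver
  import Algebra.Solver.Ring.AlmostCommutativeRing as ACR
  open import Relation.Binary.Reasoning.Setoid setoid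

  private
    module +-Solver = CommutativeMonoidSolver +-commutativeMonoid
    module *-Solver = CommutativeMonoidSolver *-commutativeMonoid

    fromℤ : ℤ → Carrier
    fromℤ (+ n)      = n ×ₙ 1#
    fromℤ -[1+ n ]   = - (ℕ.suc n ×ₙ 1#)

    fromSign : Sign → Carrier
    fromSign Sign.+ = 1#
    fromSign Sign.- = - 1#

    fromℤ-neg : ∀ i → fromℤ (ℤ.- i) ≈ - fromℤ i
    fromℤ-neg (+ ℕ.zero)  = ≈-sym -0#≈0#
    fromℤ-neg (+ ℕ.suc n) = ≈-refl
    fromℤ-neg -[1+ n ]    = ≈-sym (-‿involutive _)

    [x+a]-[x+b]≈a-b : ∀ x a b → (x + a) - (x + b) ≈ a - b
    [x+a]-[x+b]≈a-b x a b = begin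
      (x + a) - (x + b)     ≈⟨ +-congˡ (≈-sym (⁻¹-∙-comm x b)) ⟩
      (x + a) + (- x + - b) ≈⟨ +-Solver.solve 4 (λ x a x⁻ b⁻ → (x ⊕ a) ⊕ (x⁻ ⊕ b⁻) ⊜ (x ⊕ x⁻) ⊕ (a ⊕ b⁻))
                                 ≈-refl x a (- x) (- b) ⟩
      (x - x) + (a - b)     ≈⟨ +-congʳ (-‿inverseʳ x) ⟩
      0# + (a - b)          ≈⟨ +-identityˡ _ ⟩
      a - b                 ∎
      where open +-Solver using (_⊕_; _⊜_)

    fromℤ-⊖ : ∀ m n → fromℤ (m ⊖ n) ≈ m ×ₙ 1# - n ×ₙ 1#
    fromℤ-⊖ m        ℕ.zero    = ≈-sym (≈-trans (+-congˡ -0#≈0#) (+-identityʳ _))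
    fromℤ-⊖ ℕ.zero   (ℕ.suc n) = ≈-sym (+-identityˡ _)
    fromℤ-⊖ (ℕ.suc m) (ℕ.suc n) = begin
      fromℤ (ℕ.suc m ⊖ ℕ.suc n)      ≡⟨ cong fromℤ (ℤₚ.[1+m]⊖[1+n]≡m⊖n m n) ⟩
      fromℤ (m ⊖ n)                  ≈⟨ fromℤ-⊖ m n ⟩
      m ×ₙ 1# - n ×ₙ 1#              ≈⟨ [x+a]-[x+b]≈a-b 1# _ _ ⟨
      ℕ.suc m ×ₙ 1# - ℕ.suc n ×ₙ 1#  ∎

    fromℤ-+ : ∀ i j → fromℤ (i ℤ.+ j) ≈ fromℤ i + fromℤ j
    fromℤ-+ (+ m)    (+ n)    = ×-homo-+ 1# m n
    fromℤ-+ (+ m)    -[1+ n ] = fromℤ-⊖ m (ℕ.suc n)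
    fromℤ-+ -[1+ m ] (+ n)    = ≈-trans (fromℤ-⊖ n (ℕ.suc m)) (+-comm _ _)
    fromℤ-+ -[1+ m ] -[1+ n ] = begin
      - (ℕ.suc (ℕ.suc (m ℕ.+ n)) ×ₙ 1#)      ≡⟨ cong (λ k → - (ℕ.suc k ×ₙ 1#)) (ℕ.+-suc m n) ⟨
      - ((ℕ.suc m ℕ.+ ℕ.suc n) ×ₙ 1#)        ≈⟨ -‿cong (×-homo-+ 1# (ℕ.suc m) (ℕ.suc n)) ⟩
      - (ℕ.suc m ×ₙ 1# + ℕ.suc n ×ₙ 1#)      ≈⟨ ⁻¹-∙-comm _ _ ⟨
      - (ℕ.suc m ×ₙ 1#) + - (ℕ.suc n ×ₙ 1#)  ∎

    fromℤ-◃ : ∀ s n → fromℤ (s ℤ.◃ n) ≈ fromSign s * (n ×ₙ 1#)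
    fromℤ-◃ Sign.+ n = ≈-trans (≈-reflexive (cong fromℤ (ℤₚ.+◃n≡+n n))) (≈-sym (*-identityˡ _))
    fromℤ-◃ Sign.- n = begin
      fromℤ (Sign.- ℤ.◃ n) ≡⟨ cong fromℤ (ℤₚ.-◃n≡-n n) ⟩
      fromℤ (ℤ.- (+ n))    ≈⟨ fromℤ-neg (+ n) ⟩
      - (n ×ₙ 1#)          ≈⟨ -‿cong (*-identityˡ _) ⟨
      - (1# * (n ×ₙ 1#))   ≈⟨ -‿distribˡ-* 1# _ ⟩
      - 1# * (n ×ₙ 1#)     ∎

    fromSign-* : ∀ s t → fromSign (s Sign.* t) ≈ fromSign s * fromSign t
    fromSign-* Sign.+ t      = ≈-sym (*-identityˡ _)
    fromSign-* Sign.- Sign.+ = ≈-sym (*-identityʳ _)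
    fromSign-* Sign.- Sign.- = begin
      1#            ≈⟨ -‿involutive 1# ⟨
      - - 1#        ≈⟨ -‿cong (*-identityˡ _) ⟨
      - (1# * - 1#) ≈⟨ -‿distribˡ-* 1# (- 1#) ⟩
      - 1# * - 1#   ∎

    fromℤ-* : ∀ i j → fromℤ (i ℤ.* j) ≈ fromℤ i * fromℤ j
    fromℤ-* i j = begin
      fromℤ ((sign i Sign.* sign j) ℤ.◃ (∣ i ∣ ℕ.* ∣ j ∣))
        ≈⟨ fromℤ-◃ (sign i Sign.* sign j) (∣ i ∣ ℕ.* ∣ j ∣) ⟩
      fromSign (sign i Sign.* sign j) * ((∣ i ∣ ℕ.* ∣ j ∣) ×ₙ 1#)
        ≈⟨ *-cong (fromSign-* (sign i) (sign j)) (×1-homo-* ∣ i ∣ ∣ j ∣) ⟩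
      (fromSign (sign i) * fromSign (sign j)) * ((∣ i ∣ ×ₙ 1#) * (∣ j ∣ ×ₙ 1#))
        ≈⟨ *-Solver.solve 4 (λ a b x y → (a ⊕ b) ⊕ (x ⊕ y) ⊜ (a ⊕ x) ⊕ (b ⊕ y)) ≈-refl _ _ _ _ ⟩
      (fromSign (sign i) * (∣ i ∣ ×ₙ 1#)) * (fromSign (sign j) * (∣ j ∣ ×ₙ 1#))
        ≈⟨ *-cong (fromℤ-◃ (sign i) ∣ i ∣) (fromℤ-◃ (sign j) ∣ j ∣) ⟨
      fromℤ (sign i ℤ.◃ ∣ i ∣) * fromℤ (sign j ℤ.◃ ∣ j ∣)
        ≡⟨ cong₂ (λ i′ j′ → fromℤ i′ * fromℤ j′) (ℤₚ.◃-inverse i) (ℤₚ.◃-inverse j) ⟩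
      fromℤ i * fromℤ j ∎
      where open *-Solver using (_⊕_; _⊜_)

    fromℤ-morphism : ℤ.+-*-rawRing ACR.-Raw-AlmostCommutative⟶ ACR.fromCommutativeRing R
    fromℤ-morphism = record
      { ⟦_⟧    = fromℤ
      ; +-homo = fromℤ-+
      ; *-homo = fromℤ-*
      ; -‿homo = fromℤ-neg
      ; 0-homo = ≈-refl
      ; 1-homo = +-identityʳ 1#
      }

    fromℤ-≟ : ∀ i j → Maybe (fromℤ i ≈ fromℤ j)
    fromℤ-≟ i j with i ℤₚ.≟ j
    ... | yes refl = just ≈-refl
    ... | no  _    = nothing

  open import Algebra.Solver.Ring ℤ.+-*-rawRing (ACR.fromCommutativeRing R) fromℤ-morphism fromℤ-≟ public

-- An integral domain with an involution s, and elements t, x, y modelling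
-- ℚ[t, x₁, …, xₙ] with s = s_i, x = x_i and y = x_{i+1}.
record HeckeSetting {c ℓ} (R : CommutativeRing c ℓ) : Set (c ⊔ ℓ) where
  open CommutativeRing R
  field
    *-almostCancelˡ      : AlgebraDefinitions.AlmostLeftCancellative _≈_ 0# _*_
    s                    : Carrier → Carrier
    s-isRingHomomorphism : RingMorphisms.IsRingHomomorphism rawRing rawRing s
    s-involutive         : ∀ a → s (s a) ≈ a
    t x y                : Carrier
    s-t                  : s t ≈ t
    s-x                  : s x ≈ y
    t≉0                  : t ≉ 0#
    x-y≉0                : x - y ≉ 0#

module HeckeOperator {c ℓ} {R : CommutativeRing c ℓ} (setting : HeckeSetting R) where

  open CommutativeRing R renaming (refl to ≈-refl; sym to ≈-sym; trans to ≈-trans; reflexive to ≈-reflexive)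
  open HeckeSetting setting
  open RingMorphisms.IsRingHomomorphism s-isRingHomomorphism
    renaming (⟦⟧-cong to s-cong; +-homo to s-+; *-homo to s-*; -‿homo to s-neg; 0#-homo to s-0#)
  open import Algebra.Properties.Group +-group using (x∙y⁻¹≈ε⇒x≈y; x≈y⇒x∙y⁻¹≈ε)
  open IntegerCoefficients R
  open import Relation.Binary.Reasoning.Setoid setoid

  private
    *-nonZero : ∀ {a b} → a ≉ 0# → b ≉ 0# → a * b ≉ 0#
    *-nonZero {a} {b} a≉0 b≉0 ab≈0 = b≉0 (*-almostCancelˡ a b 0# a≉0 (≈-trans ab≈0 (≈-sym (zeroʳ a))))

    s-nonZero : ∀ {a} → a ≉ 0# → s a ≉ 0#
    s-nonZero {a} a≉0 sa≈0 = a≉0 (≈-trans (≈-sym (s-involutive a)) (≈-trans (s-cong sa≈0) s-0#))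

    s-- : ∀ a b → s (a - b) ≈ s a - s b
    s-- a b = ≈-trans (s-+ a (- b)) (+-congˡ (s-neg b))

    s-y : s y ≈ x
    s-y = ≈-trans (s-cong (≈-sym s-x)) (s-involutive x)

    s-[x-y] : s (x - y) ≈ y - x
    s-[x-y] = ≈-trans (s-- x y) (+-cong s-x (-‿cong s-y))

    s-[tx-y] : s (t * x - y) ≈ t * y - x
    s-[tx-y] = ≈-trans (s-- (t * x) y) (+-cong (≈-trans (s-* t x) (*-cong s-t s-x)) (-‿cong s-y))

  -- T(P/u) = Q/v for s-invariant u, v, with the division by x - y cleared as in TRel.
  Hecke : Carrier → Carrier → Carrier → Carrier → Set ℓ
  Hecke P u Q v = (x - y) * (t * P * v - Q * u) ≈ (t * x - y) * (P - s P) * v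

  -- T(P/u) = hecke P / ((x - y) u) for s-invariant u.
  hecke : Carrier → Carrier
  hecke P = t * (x - y) * P - (t * x - y) * (P - s P)

  Hecke⇒hecke : ∀ {P u Q v} → Hecke P u Q v → (x - y) * u * Q ≈ v * hecke P
  Hecke⇒hecke {P} {u} {Q} {v} TPu≈Qv = x∙y⁻¹≈ε⇒x≈y _ _ (begin
    (x - y) * u * Q - v * hecke P
      ≈⟨ solve 8 (λ x y t P sP u Q v →
           (x :- y) :* u :* Q :- v :* (t :* (x :- y) :* P :- (t :* x :- y) :* (P :- sP))
             := (t :* x :- y) :* (P :- sP) :* v :- (x :- y) :* (t :* P :* v :- Q :* u))
           ≈-refl x y t P (s P) u Q v ⟩
    (t * x - y) * (P - s P) * v - (x - y) * (t * P * v - Q * u)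
      ≈⟨ x≈y⇒x∙y⁻¹≈ε (≈-sym TPu≈Qv) ⟩
    0# ∎)

  s-hecke : ∀ P → s (hecke P) ≈ t * (y - x) * s P - (t * y - x) * (s P - P)
  s-hecke P = begin
    s (hecke P)
      ≈⟨ s-- _ _ ⟩
    s (t * (x - y) * P) - s ((t * x - y) * (P - s P))
      ≈⟨ +-cong (≈-trans (s-* _ P) (*-congʳ (≈-trans (s-* t _) (*-cong s-t s-[x-y]))))
                (-‿cong (≈-trans (s-* _ _) (*-cong s-[tx-y] (≈-trans (s-- P (s P)) (+-congˡ (-‿cong (s-involutive P))))))) ⟩
    t * (y - x) * s P - (t * y - x) * (s P - P) ∎

  hecke+s-hecke : ∀ P → hecke P + s (hecke P) ≈ (x - y) * (s P - P)
  hecke+s-hecke P = begin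
    hecke P + s (hecke P)
      ≈⟨ +-congˡ (s-hecke P) ⟩
    hecke P + (t * (y - x) * s P - (t * y - x) * (s P - P))
      ≈⟨ solve 5 (λ x y t P sP →
           (t :* (x :- y) :* P :- (t :* x :- y) :* (P :- sP)) :+ (t :* (y :- x) :* sP :- (t :* y :- x) :* (sP :- P))
             := (x :- y) :* (sP :- P))
           ≈-refl x y t P (s P) ⟩
    (x - y) * (s P - P) ∎

  -- If hecke P ≈ 0 then hecke+s-hecke forces s P ≈ P, and then hecke P ≈ t (x - y) P.
  hecke≈0⇒≈0 : ∀ {P} → hecke P ≈ 0# → P ≈ 0#
  hecke≈0⇒≈0 {P} hP≈0 = *-almostCancelˡ (t * (x - y)) P 0# (*-nonZero t≉0 x-y≉0) (begin
    t * (x - y) * P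
      ≈⟨ solve 5 (λ x y t P sP →
           t :* (x :- y) :* P := (t :* (x :- y) :* P :- (t :* x :- y) :* (P :- sP)) :+ (t :* x :- y) :* (P :- sP))
           ≈-refl x y t P (s P) ⟩
    hecke P + (t * x - y) * (P - s P)
      ≈⟨ +-cong hP≈0 (*-congˡ (x≈y⇒x∙y⁻¹≈ε (≈-sym sP≈P))) ⟩
    0# + (t * x - y) * 0#
      ≈⟨ solve 3 (λ x y t → con (+ 0) :+ (t :* x :- y) :* con (+ 0) := t :* (x :- y) :* con (+ 0)) ≈-refl x y t ⟩
    t * (x - y) * 0# ∎)
    where
    sP≈P : s P ≈ P
    sP≈P = x∙y⁻¹≈ε⇒x≈y _ _ (*-almostCancelˡ (x - y) _ 0# x-y≉0 (begin
      (x - y) * (s P - P)   ≈⟨ hecke+s-hecke P ⟨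
      hecke P + s (hecke P) ≈⟨ +-cong hP≈0 (≈-trans (s-cong hP≈0) s-0#) ⟩
      0# + 0#               ≈⟨ +-identityʳ 0# ⟩
      0#                    ≈⟨ zeroʳ (x - y) ⟨
      (x - y) * 0#          ∎))

  Hecke-nonZero : ∀ {P u Q v} → v ≉ 0# → P ≉ 0# → Hecke P u Q v → Q ≉ 0#
  Hecke-nonZero {P} {u} {Q} {v} v≉0 P≉0 TPu≈Qv Q≈0 = P≉0 (hecke≈0⇒≈0 (*-almostCancelˡ v _ 0# v≉0 (begin
    v * hecke P      ≈⟨ Hecke⇒hecke TPu≈Qv ⟨
    (x - y) * u * Q  ≈⟨ *-congˡ Q≈0 ⟩
    (x - y) * u * 0# ≈⟨ zeroʳ _ ⟩
    0#               ≈⟨ zeroʳ v ⟨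
    v * 0#           ∎)))

  s-respects-invariant-ratio : ∀ {Q P c d} → c ≉ 0# → s c * d ≈ c * s d → Q * c ≈ P * d → s Q * c ≈ s P * d
  s-respects-invariant-ratio {Q} {P} {c} {d} c≉0 d/c-invariant Qc≈Pd = *-almostCancelˡ (s c) _ _ (s-nonZero c≉0) (begin
    s c * (s Q * c)   ≈⟨ solve 3 (λ sc sQ c → sc :* (sQ :* c) := c :* (sQ :* sc)) ≈-refl (s c) (s Q) c ⟩
    c * (s Q * s c)   ≈⟨ *-congˡ (≈-trans (≈-sym (s-* Q c)) (≈-trans (s-cong Qc≈Pd) (s-* P d))) ⟩
    c * (s P * s d)   ≈⟨ solve 3 (λ c sP sd → c :* (sP :* sd) := sP :* (c :* sd)) ≈-refl c (s P) (s d) ⟩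
    s P * (c * s d)   ≈⟨ *-congˡ d/c-invariant ⟨
    s P * (s c * d)   ≈⟨ solve 3 (λ sP sc d → sP :* (sc :* d) := sc :* (sP :* d)) ≈-refl (s P) (s c) d ⟩
    s c * (s P * d)   ∎)

  hecke-respects-ratio : ∀ {Q P c d} → Q * c ≈ P * d → s Q * c ≈ s P * d → hecke Q * c ≈ hecke P * d
  hecke-respects-ratio {Q} {P} {c} {d} Qc≈Pd sQc≈sPd = x∙y⁻¹≈ε⇒x≈y _ _ (begin
    hecke Q * c - hecke P * d
      ≈⟨ solve 9 (λ x y t Q sQ P sP c d →
           (t :* (x :- y) :* Q :- (t :* x :- y) :* (Q :- sQ)) :* c :- (t :* (x :- y) :* P :- (t :* x :- y) :* (P :- sP)) :* d
             := (t :* (x :- y) :- (t :* x :- y)) :* (Q :* c :- P :* d) :+ (t :* x :- y) :* (sQ :* c :- sP :* d))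
           ≈-refl x y t Q (s Q) P (s P) c d ⟩
    (t * (x - y) - (t * x - y)) * (Q * c - P * d) + (t * x - y) * (s Q * c - s P * d)
      ≈⟨ +-cong (*-congˡ (x≈y⇒x∙y⁻¹≈ε Qc≈Pd)) (*-congˡ (x≈y⇒x∙y⁻¹≈ε sQc≈sPd)) ⟩
    (t * (x - y) - (t * x - y)) * 0# + (t * x - y) * 0#
      ≈⟨ solve 3 (λ x y t → (t :* (x :- y) :- (t :* x :- y)) :* con (+ 0) :+ (t :* x :- y) :* con (+ 0) := con (+ 0)) ≈-refl x y t ⟩
    0# ∎)

  -- If Q/u′ = (N/D)(P/u) with N/D s-invariant, then T(Q/u′) = (N/D) T(P/u).
  Hecke-invariant-multiple : ∀ {P u P′ v Q u′ Q′ v′ N D} →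
    u ≉ 0# → u′ ≉ 0# → D ≉ 0# → s u ≈ u → s u′ ≈ u′ → s N * D ≈ N * s D →
    Q * u * D ≈ N * (P * u′) → Hecke P u P′ v → Hecke Q u′ Q′ v′ →
    Q′ * v * D ≈ N * (P′ * v′)
  Hecke-invariant-multiple {P} {u} {P′} {v} {Q} {u′} {Q′} {v′} {N} {D}
    u≉0 u′≉0 D≉0 su≈u su′≈u′ N/D-invariant Qu′≈NP/uD TPu≈P′v TQu′≈Q′v′ =
    *-almostCancelˡ ((x - y) * u * u′) _ _ (*-nonZero (*-nonZero x-y≉0 u≉0) u′≉0) (begin
      (x - y) * u * u′ * (Q′ * v * D)
        ≈⟨ solve 6 (λ X u u′ Q′ v D → X :* u :* u′ :* (Q′ :* v :* D) := X :* u′ :* Q′ :* (v :* (u :* D)))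
             ≈-refl (x - y) u u′ Q′ v D ⟩
      (x - y) * u′ * Q′ * (v * (u * D))
        ≈⟨ *-congʳ (Hecke⇒hecke TQu′≈Q′v′) ⟩
      v′ * hecke Q * (v * (u * D))
        ≈⟨ solve 5 (λ v′ hQ v u D → v′ :* hQ :* (v :* (u :* D)) := hQ :* (u :* D) :* (v :* v′)) ≈-refl v′ (hecke Q) v u D ⟩
      hecke Q * (u * D) * (v * v′)
        ≈⟨ *-congʳ (hecke-respects-ratio Qc≈Pd (s-respects-invariant-ratio (*-nonZero u≉0 D≉0) d/c-invariant Qc≈Pd)) ⟩
      hecke P * (N * u′) * (v * v′)
        ≈⟨ solve 5 (λ hP N u′ v v′ → hP :* (N :* u′) :* (v :* v′) := v :* hP :* (N :* u′ :* v′)) ≈-refl (hecke P) N u′ v v′ ⟩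
      v * hecke P * (N * u′ * v′)
        ≈⟨ *-congʳ (Hecke⇒hecke TPu≈P′v) ⟨
      (x - y) * u * P′ * (N * u′ * v′)
        ≈⟨ solve 6 (λ X u P′ N u′ v′ → X :* u :* P′ :* (N :* u′ :* v′) := X :* u :* u′ :* (N :* (P′ :* v′)))
             ≈-refl (x - y) u P′ N u′ v′ ⟩
      (x - y) * u * u′ * (N * (P′ * v′)) ∎)
    where
    Qc≈Pd : Q * (u * D) ≈ P * (N * u′)
    Qc≈Pd = begin
      Q * (u * D)    ≈⟨ solve 3 (λ Q u D → Q :* (u :* D) := Q :* u :* D) ≈-refl Q u D ⟩
      Q * u * D      ≈⟨ Qu′≈NP/uD ⟩
      N * (P * u′)   ≈⟨ solve 3 (λ N P u′ → N :* (P :* u′) := P :* (N :* u′)) ≈-refl N P u′ ⟩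
      P * (N * u′)   ∎
    d/c-invariant : s (u * D) * (N * u′) ≈ (u * D) * s (N * u′)
    d/c-invariant = begin
      s (u * D) * (N * u′)   ≈⟨ *-congʳ (≈-trans (s-* u D) (*-congʳ su≈u)) ⟩
      u * s D * (N * u′)     ≈⟨ solve 4 (λ u sD N u′ → u :* sD :* (N :* u′) := u :* u′ :* (N :* sD)) ≈-refl u (s D) N u′ ⟩
      u * u′ * (N * s D)     ≈⟨ *-congˡ N/D-invariant ⟨
      u * u′ * (s N * D)     ≈⟨ solve 4 (λ u u′ sN D → u :* u′ :* (sN :* D) := u :* D :* (sN :* u′)) ≈-refl u u′ (s N) D ⟩
      u * D * (s N * u′)     ≈⟨ *-congˡ (≈-trans (s-* N u′) (*-congˡ su′≈u′)) ⟨
      u * D * s (N * u′)     ∎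

-- Polynomials: finite sums, coefficients and the ring structure

private
  module +ℚ = Algebra.Properties.CommutativeSemigroup (CommutativeMonoid.commutativeSemigroup ℚ.+-0-commutativeMonoid)
  module *ℚ = Algebra.Properties.CommutativeSemigroup (CommutativeMonoid.commutativeSemigroup ℚ.*-1-commutativeMonoid)

∑ : {A : Set} → List A → (A → ℚ) → ℚ
∑ []       F = 0ℚ
∑ (x ∷ xs) F = F x +ℚ ∑ xs F

module _ {A : Set} where

  ∑-cong : ∀ (xs : List A) {F G : A → ℚ} → (∀ x → F x ≡ G x) → ∑ xs F ≡ ∑ xs G
  ∑-cong []       F≗G = refl
  ∑-cong (x ∷ xs) F≗G = cong₂ _+ℚ_ (F≗G x) (∑-cong xs F≗G)

  ∑-++ : ∀ (xs ys : List A) F → ∑ (xs ++ ys) F ≡ ∑ xs F +ℚ ∑ ys F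
  ∑-++ []       ys F = sym (ℚ.+-identityˡ _)
  ∑-++ (x ∷ xs) ys F = trans (cong (F x +ℚ_) (∑-++ xs ys F)) (sym (ℚ.+-assoc (F x) _ _))

  ∑-+ : ∀ (xs : List A) F G → ∑ xs (λ x → F x +ℚ G x) ≡ ∑ xs F +ℚ ∑ xs G
  ∑-+ []       F G = refl
  ∑-+ (x ∷ xs) F G = trans (cong (F x +ℚ G x +ℚ_) (∑-+ xs F G)) (+ℚ.interchange (F x) (G x) (∑ xs F) (∑ xs G))

  ∑-*ˡ : ∀ (xs : List A) c F → ∑ xs (λ x → c *ℚ F x) ≡ c *ℚ ∑ xs F
  ∑-*ˡ []       c F = sym (ℚ.*-zeroʳ c)
  ∑-*ˡ (x ∷ xs) c F = trans (cong (c *ℚ F x +ℚ_) (∑-*ˡ xs c F)) (sym (ℚ.*-distribˡ-+ c (F x) (∑ xs F)))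

  ∑-neg : ∀ (xs : List A) F → ∑ xs (λ x → -ℚ F x) ≡ -ℚ ∑ xs F
  ∑-neg []       F = refl
  ∑-neg (x ∷ xs) F = trans (cong (-ℚ F x +ℚ_) (∑-neg xs F)) (sym (ℚ.neg-distrib-+ (F x) (∑ xs F)))

  ∑-vanishes : ∀ (xs : List A) F → (∀ x → x ∈ xs → F x ≡ 0ℚ) → ∑ xs F ≡ 0ℚ
  ∑-vanishes []       F F≡0 = refl
  ∑-vanishes (x ∷ xs) F F≡0 =
    cong₂ _+ℚ_ (F≡0 x (here refl)) (∑-vanishes xs F (λ y y∈xs → F≡0 y (there y∈xs)))

  ∑-unique-support : ∀ {xs : List A} F {x} → Unique xs → x ∈ xs →
                     (∀ y → y ∈ xs → y ≢ x → F y ≡ 0ℚ) → ∑ xs F ≡ F x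
  ∑-unique-support F (x≢xs ∷ _) (here refl) F≡0 = trans
    (cong (F _ +ℚ_) (∑-vanishes _ F (λ y y∈xs → F≡0 y (there y∈xs) (≢-sym (All.lookup x≢xs y∈xs)))))
    (ℚ.+-identityʳ _)
  ∑-unique-support F (y≢xs ∷ xs!) (there x∈xs) F≡0 = trans
    (cong₂ _+ℚ_ (F≡0 _ (here refl) (All.lookup y≢xs x∈xs)) (∑-unique-support F xs! x∈xs (λ z z∈xs → F≡0 z (there z∈xs))))
    (ℚ.+-identityˡ _)

module _ {A B : Set} where

  ∑-map : ∀ (f : A → B) (xs : List A) F → ∑ (map f xs) F ≡ ∑ xs (λ x → F (f x))
  ∑-map f []       F = refl
  ∑-map f (x ∷ xs) F = cong (F (f x) +ℚ_) (∑-map f xs F)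

  ∑-concatMap : ∀ (f : A → List B) (xs : List A) F → ∑ (concatMap f xs) F ≡ ∑ xs (λ x → ∑ (f x) F)
  ∑-concatMap f []       F = refl
  ∑-concatMap f (x ∷ xs) F = trans (∑-++ (f x) (concatMap f xs) F) (cong (∑ (f x) F +ℚ_) (∑-concatMap f xs F))

  ∑-comm : ∀ (xs : List A) (ys : List B) (G : A → B → ℚ) → ∑ xs (λ x → ∑ ys (G x)) ≡ ∑ ys (λ y → ∑ xs (λ x → G x y))
  ∑-comm []       ys G = sym (∑-vanishes ys _ (λ _ _ → refl))
  ∑-comm (x ∷ xs) ys G = trans (cong (∑ ys (G x) +ℚ_) (∑-comm xs ys G)) (sym (∑-+ ys (G x) (λ y → ∑ xs (λ x′ → G x′ y))))

product-vanishes : ∀ {a b : ℚ} → (a ≢ 0ℚ → b ≡ 0ℚ) → a *ℚ b ≡ 0ℚ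
product-vanishes {a} {b} b≡0 with a ℚ.≟ 0ℚ
... | yes refl = ℚ.*-zeroˡ b
... | no  a≢0  = trans (cong (a *ℚ_) (b≡0 a≢0)) (ℚ.*-zeroʳ a)

module _ {n : ℕ} where

  infixl 6 _⊕_
  _⊕_ : Mon n → Mon n → Mon n
  _⊕_ = zipWith ℕ._+_

  0ₘ : Mon n
  0ₘ = replicate (ℕ.suc n) 0

  monomials : Poly n → List (Mon n)
  monomials = map proj₂

  Σₚ : Poly n → (Mon n → ℚ) → ℚ
  Σₚ p F = ∑ p (λ (a , γ) → a *ℚ F γ)

  indicator : Mon n → Mon n → ℚ
  indicator α γ with Vec.≡-dec ℕ._≟_ γ α
  ... | yes _ = 1ℚ
  ... | no  _ = 0ℚ

  indicator-≡ : ∀ α → indicator α α ≡ 1ℚ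
  indicator-≡ α with Vec.≡-dec ℕ._≟_ α α
  ... | yes _   = refl
  ... | no  α≢α = contradiction refl α≢α

  indicator-≢ : ∀ {α γ} → γ ≢ α → indicator α γ ≡ 0ℚ
  indicator-≢ {α} {γ} γ≢α with Vec.≡-dec ℕ._≟_ γ α
  ... | yes γ≡α = contradiction γ≡α γ≢α
  ... | no  _   = refl

  coeff-∷ : ∀ a β p γ → coeff ((a , β) ∷ p) γ ≡ a *ℚ indicator γ β +ℚ coeff p γ
  coeff-∷ a β p γ with Vec.≡-dec ℕ._≟_ β γ
  ... | yes _ = cong (_+ℚ coeff p γ) (sym (ℚ.*-identityʳ a))
  ... | no  _ = sym (trans (cong (_+ℚ coeff p γ) (ℚ.*-zeroʳ a)) (ℚ.+-identityˡ _))

  coeff-Σₚ : ∀ p α → coeff p α ≡ Σₚ p (indicator α)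
  coeff-Σₚ []            α = refl
  coeff-Σₚ ((a , β) ∷ p) α = trans (coeff-∷ a β p α) (cong (a *ℚ indicator α β +ℚ_) (coeff-Σₚ p α))

  coeff-monomial : ∀ a α → coeff ((a , α) ∷ []) α ≡ a
  coeff-monomial a α = begin
    coeff ((a , α) ∷ []) α     ≡⟨ coeff-∷ a α [] α ⟩
    a *ℚ indicator α α +ℚ 0ℚ   ≡⟨ ℚ.+-identityʳ _ ⟩
    a *ℚ indicator α α         ≡⟨ cong (a *ℚ_) (indicator-≡ α) ⟩
    a *ℚ 1ℚ                    ≡⟨ ℚ.*-identityʳ a ⟩
    a                          ∎
    where open ≡-Reasoning

  Σₚ-cong : ∀ p {F G : Mon n → ℚ} → (∀ γ → F γ ≡ G γ) → Σₚ p F ≡ Σₚ p G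
  Σₚ-cong p F≗G = ∑-cong p (λ (a , γ) → cong (a *ℚ_) (F≗G γ))

  Σₚ-++ : ∀ p q F → Σₚ (p ++ q) F ≡ Σₚ p F +ℚ Σₚ q F
  Σₚ-++ p q F = ∑-++ p q _

  Σₚ-*ˡ : ∀ p c F → Σₚ p (λ γ → c *ℚ F γ) ≡ c *ℚ Σₚ p F
  Σₚ-*ˡ p c F = trans (∑-cong p (λ (a , γ) → *ℚ.x∙yz≈y∙xz a c (F γ))) (∑-*ˡ p c _)

  Σₚ-comm : ∀ p q (G : Mon n → Mon n → ℚ) → Σₚ p (λ γ → Σₚ q (G γ)) ≡ Σₚ q (λ δ → Σₚ p (λ γ → G γ δ))
  Σₚ-comm p q G = begin
    ∑ p (λ (a , γ) → a *ℚ Σₚ q (G γ))                  ≡⟨ ∑-cong p (λ (a , γ) → sym (Σₚ-*ˡ q a (G γ))) ⟩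
    ∑ p (λ (a , γ) → ∑ q (λ (b , δ) → b *ℚ (a *ℚ G γ δ))) ≡⟨ ∑-comm p q _ ⟩
    ∑ q (λ (b , δ) → ∑ p (λ (a , γ) → b *ℚ (a *ℚ G γ δ))) ≡⟨ ∑-cong q (λ (b , δ) → ∑-*ˡ p b _) ⟩
    ∑ q (λ (b , δ) → b *ℚ Σₚ p (λ γ → G γ δ))          ∎
    where open ≡-Reasoning

  Σₚ-neg : ∀ p F → Σₚ (-ₚ p) F ≡ -ℚ Σₚ p F
  Σₚ-neg p F = trans (∑-map _ p _) (trans (∑-cong p (λ (a , γ) → sym (ℚ.neg-distribˡ-* a (F γ)))) (∑-neg p _))

  Σₚ-*ₚ : ∀ p q F → Σₚ (p *ₚ q) F ≡ Σₚ p (λ γ → Σₚ q (λ δ → F (γ ⊕ δ)))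
  Σₚ-*ₚ p q F = trans (∑-concatMap _ p _) (∑-cong p (λ (a , γ) → begin
    ∑ (map (λ (b , δ) → (a *ℚ b , γ ⊕ δ)) q) (λ (c , ε) → c *ℚ F ε) ≡⟨ ∑-map _ q _ ⟩
    ∑ q (λ (b , δ) → a *ℚ b *ℚ F (γ ⊕ δ))                           ≡⟨ ∑-cong q (λ (b , δ) → ℚ.*-assoc a b _) ⟩
    ∑ q (λ (b , δ) → a *ℚ (b *ℚ F (γ ⊕ δ)))                         ≡⟨ ∑-*ˡ q a _ ⟩
    a *ℚ Σₚ q (λ δ → F (γ ⊕ δ))                                   ∎))
    where open ≡-Reasoning

  -- Collecting like terms: a polynomial's list of terms may repeat monomials.
  Σₚ-grouped : ∀ p F {D} → Unique D → (∀ {γ} → γ ∈ monomials p → γ ∈ D) →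
               Σₚ p F ≡ ∑ D (λ γ → coeff p γ *ℚ F γ)
  Σₚ-grouped []            F {D} D! p⊆D = sym (∑-vanishes D _ (λ γ _ → ℚ.*-zeroˡ (F γ)))
  Σₚ-grouped ((a , β) ∷ p) F {D} D! p⊆D = begin
    a *ℚ F β +ℚ Σₚ p F
      ≡⟨ cong₂ _+ℚ_ (sym term-β) (Σₚ-grouped p F D! (λ γ∈p → p⊆D (there γ∈p))) ⟩
    ∑ D (λ γ → a *ℚ indicator γ β *ℚ F γ) +ℚ ∑ D (λ γ → coeff p γ *ℚ F γ)
      ≡⟨ sym (∑-+ D _ _) ⟩
    ∑ D (λ γ → a *ℚ indicator γ β *ℚ F γ +ℚ coeff p γ *ℚ F γ)
      ≡⟨ ∑-cong D (λ γ → trans (sym (ℚ.*-distribʳ-+ (F γ) (a *ℚ indicator γ β) (coeff p γ)))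
                              (cong (_*ℚ F γ) (sym (coeff-∷ a β p γ)))) ⟩
    ∑ D (λ γ → coeff ((a , β) ∷ p) γ *ℚ F γ) ∎
    where
    open ≡-Reasoning
    term-β : ∑ D (λ γ → a *ℚ indicator γ β *ℚ F γ) ≡ a *ℚ F β
    term-β = begin
      ∑ D (λ γ → a *ℚ indicator γ β *ℚ F γ) ≡⟨ ∑-unique-support _ D! (p⊆D (here refl))
                                               (λ γ _ γ≢β → trans (cong (λ i → a *ℚ i *ℚ F γ) (indicator-≢ (≢-sym γ≢β)))
                                                                     (trans (cong (_*ℚ F γ) (ℚ.*-zeroʳ a)) (ℚ.*-zeroˡ (F γ)))) ⟩
      a *ℚ indicator β β *ℚ F β             ≡⟨ cong (λ i → a *ℚ i *ℚ F β) (indicator-≡ β) ⟩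
      a *ℚ 1ℚ *ℚ F β                        ≡⟨ cong (_*ℚ F β) (ℚ.*-identityʳ a) ⟩
      a *ℚ F β                             ∎

  private
    dedup : List (Mon n) → List (Mon n)
    dedup = deduplicate (Vec.≡-dec ℕ._≟_)

    dedup-unique : ∀ xs → Unique (dedup xs)
    dedup-unique = deduplicate-! (Vec.≡-dec ℕ._≟_)

    ∈-dedup : ∀ {xs γ} → γ ∈ xs → γ ∈ dedup xs
    ∈-dedup = ∈-deduplicate⁺ (Vec.≡-dec ℕ._≟_)

  Σₚ-resp-≈ₚ : ∀ p q F → p ≈ₚ q → Σₚ p F ≡ Σₚ q F
  Σₚ-resp-≈ₚ p q F p≈q = begin
    Σₚ p F                      ≡⟨ Σₚ-grouped p F D! (λ γ∈p → ∈-dedup (∈-++⁺ˡ γ∈p)) ⟩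
    ∑ D (λ γ → coeff p γ *ℚ F γ) ≡⟨ ∑-cong D (λ γ → cong (_*ℚ F γ) (p≈q γ)) ⟩
    ∑ D (λ γ → coeff q γ *ℚ F γ) ≡⟨ sym (Σₚ-grouped q F D! (λ γ∈q → ∈-dedup (∈-++⁺ʳ (monomials p) γ∈q))) ⟩
    Σₚ q F                      ∎
    where
    open ≡-Reasoning
    D = dedup (monomials p ++ monomials q)
    D! = dedup-unique (monomials p ++ monomials q)

  Σₚ-vanishes : ∀ p F → (∀ γ → coeff p γ ≢ 0ℚ → F γ ≡ 0ℚ) → Σₚ p F ≡ 0ℚ
  Σₚ-vanishes p F F≡0 = trans (Σₚ-grouped p F (dedup-unique (monomials p)) ∈-dedup)
    (∑-vanishes (dedup (monomials p)) _ (λ γ _ → product-vanishes (F≡0 γ)))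

  Σₚ-supported-at : ∀ p F β → (∀ γ → coeff p γ ≢ 0ℚ → γ ≢ β → F γ ≡ 0ℚ) → Σₚ p F ≡ coeff p β *ℚ F β
  Σₚ-supported-at p F β F≡0 = trans (Σₚ-grouped p F (dedup-unique (β ∷ monomials p)) (λ γ∈p → ∈-dedup {β ∷ monomials p} (there γ∈p)))
    (∑-unique-support _ (dedup-unique (β ∷ monomials p)) (∈-dedup {β ∷ monomials p} (here refl))
      (λ γ _ γ≢β → product-vanishes (λ cγ≢0 → F≡0 γ cγ≢0 γ≢β)))

  coeff-++ : ∀ p q α → coeff (p +ₚ q) α ≡ coeff p α +ℚ coeff q α
  coeff-++ p q α = begin
    coeff (p ++ q) α                                 ≡⟨ coeff-Σₚ (p ++ q) α ⟩
    Σₚ (p ++ q) (indicator α)                        ≡⟨ Σₚ-++ p q _ ⟩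
    Σₚ p (indicator α) +ℚ Σₚ q (indicator α)          ≡⟨ sym (cong₂ _+ℚ_ (coeff-Σₚ p α) (coeff-Σₚ q α)) ⟩
    coeff p α +ℚ coeff q α                            ∎
    where open ≡-Reasoning

  coeff-neg : ∀ p α → coeff (-ₚ p) α ≡ -ℚ coeff p α
  coeff-neg p α = trans (coeff-Σₚ (-ₚ p) α) (trans (Σₚ-neg p _) (cong -ℚ_ (sym (coeff-Σₚ p α))))

  coeff-*ₚ : ∀ p q α → coeff (p *ₚ q) α ≡ Σₚ p (λ γ → Σₚ q (λ δ → indicator α (γ ⊕ δ)))
  coeff-*ₚ p q α = trans (coeff-Σₚ (p *ₚ q) α) (Σₚ-*ₚ p q _)

  1ₚ : Poly n
  1ₚ = (1ℚ , 0ₘ) ∷ []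

  private
    ⊕-comm : ∀ γ δ → γ ⊕ δ ≡ δ ⊕ γ
    ⊕-comm = Vec.zipWith-comm ℕ.+-comm

    ⊕-assoc : ∀ γ δ ε → (γ ⊕ δ) ⊕ ε ≡ γ ⊕ (δ ⊕ ε)
    ⊕-assoc = Vec.zipWith-assoc ℕ.+-assoc

    ⊕-identityˡ : ∀ γ → 0ₘ ⊕ γ ≡ γ
    ⊕-identityˡ = Vec.zipWith-identityˡ ℕ.+-identityˡ

  +ₚ-cong : ∀ {p p′ q q′} → p ≈ₚ p′ → q ≈ₚ q′ → p +ₚ q ≈ₚ p′ +ₚ q′
  +ₚ-cong {p} {p′} {q} {q′} p≈p′ q≈q′ α =
    trans (coeff-++ p q α) (trans (cong₂ _+ℚ_ (p≈p′ α) (q≈q′ α)) (sym (coeff-++ p′ q′ α)))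

  +ₚ-comm : ∀ p q → p +ₚ q ≈ₚ q +ₚ p
  +ₚ-comm p q α = trans (coeff-++ p q α) (trans (ℚ.+-comm (coeff p α) (coeff q α)) (sym (coeff-++ q p α)))

  -ₚ-cong : ∀ {p q} → p ≈ₚ q → -ₚ p ≈ₚ -ₚ q
  -ₚ-cong {p} {q} p≈q α = trans (coeff-neg p α) (trans (cong -ℚ_ (p≈q α)) (sym (coeff-neg q α)))

  -ₚ-inverseˡ : ∀ p → -ₚ p +ₚ p ≈ₚ []
  -ₚ-inverseˡ p α = trans (coeff-++ (-ₚ p) p α) (trans (cong (_+ℚ coeff p α) (coeff-neg p α)) (ℚ.+-inverseˡ (coeff p α)))

  *ₚ-cong : ∀ {p p′ q q′} → p ≈ₚ p′ → q ≈ₚ q′ → p *ₚ q ≈ₚ p′ *ₚ q′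
  *ₚ-cong {p} {p′} {q} {q′} p≈p′ q≈q′ α = begin
    coeff (p *ₚ q) α                                     ≡⟨ coeff-*ₚ p q α ⟩
    Σₚ p (λ γ → Σₚ q (λ δ → indicator α (γ ⊕ δ)))        ≡⟨ Σₚ-resp-≈ₚ p p′ _ p≈p′ ⟩
    Σₚ p′ (λ γ → Σₚ q (λ δ → indicator α (γ ⊕ δ)))       ≡⟨ Σₚ-cong p′ (λ γ → Σₚ-resp-≈ₚ q q′ _ q≈q′) ⟩
    Σₚ p′ (λ γ → Σₚ q′ (λ δ → indicator α (γ ⊕ δ)))      ≡⟨ coeff-*ₚ p′ q′ α ⟨
    coeff (p′ *ₚ q′) α                                   ∎
    where open ≡-Reasoning

  *ₚ-comm : ∀ p q → p *ₚ q ≈ₚ q *ₚ p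
  *ₚ-comm p q α = begin
    coeff (p *ₚ q) α                                ≡⟨ coeff-*ₚ p q α ⟩
    Σₚ p (λ γ → Σₚ q (λ δ → indicator α (γ ⊕ δ)))   ≡⟨ Σₚ-comm p q _ ⟩
    Σₚ q (λ δ → Σₚ p (λ γ → indicator α (γ ⊕ δ)))   ≡⟨ Σₚ-cong q (λ δ → Σₚ-cong p (λ γ → cong (indicator α) (⊕-comm γ δ))) ⟩
    Σₚ q (λ δ → Σₚ p (λ γ → indicator α (δ ⊕ γ)))   ≡⟨ coeff-*ₚ q p α ⟨
    coeff (q *ₚ p) α                                ∎
    where open ≡-Reasoning

  *ₚ-assoc : ∀ p q r → (p *ₚ q) *ₚ r ≈ₚ p *ₚ (q *ₚ r)
  *ₚ-assoc p q r α = begin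
    coeff ((p *ₚ q) *ₚ r) α
      ≡⟨ coeff-*ₚ (p *ₚ q) r α ⟩
    Σₚ (p *ₚ q) (λ μ → Σₚ r (λ ε → indicator α (μ ⊕ ε)))
      ≡⟨ Σₚ-*ₚ p q _ ⟩
    Σₚ p (λ γ → Σₚ q (λ δ → Σₚ r (λ ε → indicator α ((γ ⊕ δ) ⊕ ε))))
      ≡⟨ Σₚ-cong p (λ γ → Σₚ-cong q (λ δ → Σₚ-cong r (λ ε → cong (indicator α) (⊕-assoc γ δ ε)))) ⟩
    Σₚ p (λ γ → Σₚ q (λ δ → Σₚ r (λ ε → indicator α (γ ⊕ (δ ⊕ ε)))))
      ≡⟨ Σₚ-cong p (λ γ → Σₚ-*ₚ q r _) ⟨
    Σₚ p (λ γ → Σₚ (q *ₚ r) (λ ν → indicator α (γ ⊕ ν)))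
      ≡⟨ coeff-*ₚ p (q *ₚ r) α ⟨
    coeff (p *ₚ (q *ₚ r)) α ∎
    where open ≡-Reasoning

  *ₚ-identityˡ : ∀ p → 1ₚ *ₚ p ≈ₚ p
  *ₚ-identityˡ p α = begin
    coeff (1ₚ *ₚ p) α                          ≡⟨ coeff-*ₚ 1ₚ p α ⟩
    1ℚ *ℚ Σₚ p (λ δ → indicator α (0ₘ ⊕ δ)) +ℚ 0ℚ ≡⟨ ℚ.+-identityʳ _ ⟩
    1ℚ *ℚ Σₚ p (λ δ → indicator α (0ₘ ⊕ δ))      ≡⟨ ℚ.*-identityˡ _ ⟩
    Σₚ p (λ δ → indicator α (0ₘ ⊕ δ))           ≡⟨ Σₚ-cong p (λ δ → cong (indicator α) (⊕-identityˡ δ)) ⟩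
    Σₚ p (indicator α)                         ≡⟨ coeff-Σₚ p α ⟨
    coeff p α                                  ∎
    where open ≡-Reasoning

  *ₚ-distribʳ : ∀ p q r → (q +ₚ r) *ₚ p ≈ₚ q *ₚ p +ₚ r *ₚ p
  *ₚ-distribʳ p q r α = begin
    coeff ((q ++ r) *ₚ p) α                        ≡⟨ coeff-*ₚ (q ++ r) p α ⟩
    Σₚ (q ++ r) G                                  ≡⟨ Σₚ-++ q r G ⟩
    Σₚ q G +ℚ Σₚ r G                                ≡⟨ cong₂ _+ℚ_ (coeff-*ₚ q p α) (coeff-*ₚ r p α) ⟨
    coeff (q *ₚ p) α +ℚ coeff (r *ₚ p) α            ≡⟨ coeff-++ (q *ₚ p) (r *ₚ p) α ⟨
    coeff (q *ₚ p +ₚ r *ₚ p) α                     ∎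
    where
    open ≡-Reasoning
    G = λ γ → Σₚ p (λ δ → indicator α (γ ⊕ δ))

Poly-isCommutativeRing : ∀ n → IsCommutativeRing (_≈ₚ_ {n}) _+ₚ_ _*ₚ_ -ₚ_ [] 1ₚ
Poly-isCommutativeRing n = record
  { isRing = record
    { +-isAbelianGroup = record
      { isGroup = record
        { isMonoid = record
          { isSemigroup = record
            { isMagma = record
              { isEquivalence = record
                { refl  = λ _ → refl
                ; sym   = λ p≈q α → sym (p≈q α)
                ; trans = λ p≈q q≈r α → trans (p≈q α) (q≈r α) }
              ; ∙-cong = λ {p p′ q q′} → +ₚ-cong {p = p} {p′ = p′} {q = q} {q′ = q′} }
            ; assoc = λ p q r α → cong (λ s → coeff s α) (List.++-assoc p q r) }
          ; identity = (λ p α → refl) , (λ p α → cong (λ s → coeff s α) (List.++-identityʳ p)) }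
        ; inverse = -ₚ-inverseˡ , (λ p α → trans (+ₚ-comm p (-ₚ p) α) (-ₚ-inverseˡ p α))
        ; ⁻¹-cong = λ {p q} → -ₚ-cong {p = p} {q = q} }
      ; comm = +ₚ-comm }
    ; *-cong = λ {p p′ q q′} → *ₚ-cong {p = p} {p′ = p′} {q = q} {q′ = q′}
    ; *-assoc = *ₚ-assoc
    ; *-identity = *ₚ-identityˡ , (λ p α → trans (*ₚ-comm p 1ₚ α) (*ₚ-identityˡ p α))
    ; distrib = *ₚ-distribˡ , *ₚ-distribʳ }
  ; *-comm = *ₚ-comm }
  where
  *ₚ-distribˡ : ∀ (p q r : Poly n) → p *ₚ (q +ₚ r) ≈ₚ p *ₚ q +ₚ p *ₚ r
  *ₚ-distribˡ p q r α = trans (*ₚ-comm p (q +ₚ r) α) (trans (*ₚ-distribʳ p q r α)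
    (+ₚ-cong {p = q *ₚ p} {p′ = p *ₚ q} {q = r *ₚ p} {q′ = p *ₚ r} (*ₚ-comm q p) (*ₚ-comm r p) α))

Poly-commutativeRing : ℕ → CommutativeRing _ _
Poly-commutativeRing n = record { isCommutativeRing = Poly-isCommutativeRing n }

-- No zero divisors

*ℚ-nonZero : ∀ {a b : ℚ} → a ≢ 0ℚ → b ≢ 0ℚ → a *ℚ b ≢ 0ℚ
*ℚ-nonZero {a} {b} a≢0 b≢0 ab≡0 = b≢0 (begin
  b                ≡⟨ ℚ.*-identityˡ b ⟨
  1ℚ *ℚ b          ≡⟨ cong (_*ℚ b) (ℚ.*-inverseˡ a) ⟨
  a⁻¹ *ℚ a *ℚ b    ≡⟨ ℚ.*-assoc a⁻¹ a b ⟩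
  a⁻¹ *ℚ (a *ℚ b)  ≡⟨ cong (a⁻¹ *ℚ_) ab≡0 ⟩
  a⁻¹ *ℚ 0ℚ        ≡⟨ ℚ.*-zeroʳ a⁻¹ ⟩
  0ℚ               ∎)
  where
  open ≡-Reasoning
  instance _ = ≢-nonZero a≢0
  a⁻¹ = 1/ a

module _ {m : ℕ} where

  private
    module Lexₘ = StrictTotalOrder (Lex.<-strictTotalOrder ℕ.<-strictTotalOrder m)

  infix 4 _<ₗₑₓ_
  _<ₗₑₓ_ : Vec ℕ m → Vec ℕ m → Set
  _<ₗₑₓ_ = Lexₘ._<_

  <ₗₑₓ-irrefl : ∀ {u} → ¬ u <ₗₑₓ u
  <ₗₑₓ-irrefl = Lexₘ.irrefl (Pointwise.≡⇒Pointwise-≡ refl)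

  <ₗₑₓ-trans : ∀ {u v w} → u <ₗₑₓ v → v <ₗₑₓ w → u <ₗₑₓ w
  <ₗₑₓ-trans = Lexₘ.trans

  <ₗₑₓ-cmp : Trichotomous _≡_ _<ₗₑₓ_
  <ₗₑₓ-cmp u v with Lexₘ.compare u v
  ... | tri< u<v u≉v u≯v = tri< u<v (λ u≡v → u≉v (Pointwise.≡⇒Pointwise-≡ u≡v)) u≯v
  ... | tri≈ u≮v u≈v u≯v = tri≈ u≮v (Pointwise.Pointwise-≡⇒≡ u≈v) u≯v
  ... | tri> u≮v u≉v u>v = tri> u≮v (λ u≡v → u≉v (Pointwise.≡⇒Pointwise-≡ u≡v)) u>v

  <ₗₑₓ⇒≢ : ∀ {u v} → u <ₗₑₓ v → u ≢ v
  <ₗₑₓ⇒≢ u<u refl = <ₗₑₓ-irrefl u<u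

⊕-monoˡ-<ₗₑₓ : ∀ {m} {u v : Vec ℕ m} w → u <ₗₑₓ v → zipWith ℕ._+_ u w <ₗₑₓ zipWith ℕ._+_ v w
⊕-monoˡ-<ₗₑₓ (z ∷ w) (Lex.this x<y refl) = Lex.this (ℕ.+-monoˡ-< z x<y) refl
⊕-monoˡ-<ₗₑₓ (z ∷ w) (Lex.next refl u<v) = Lex.next refl (⊕-monoˡ-<ₗₑₓ w u<v)

⊕-monoʳ-<ₗₑₓ : ∀ {m} (w : Vec ℕ m) {u v} → u <ₗₑₓ v → zipWith ℕ._+_ w u <ₗₑₓ zipWith ℕ._+_ w v
⊕-monoʳ-<ₗₑₓ w {u} {v} u<v =
  subst₂ _<ₗₑₓ_ (Vec.zipWith-comm ℕ.+-comm u w) (Vec.zipWith-comm ℕ.+-comm v w) (⊕-monoˡ-<ₗₑₓ w u<v)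

module _ {n : ℕ} where

  IsLeading : Poly n → Mon n → Set
  IsLeading p α = coeff p α ≢ 0ℚ × (∀ γ → coeff p γ ≢ 0ℚ → γ ≢ α → γ <ₗₑₓ α)

  coeff≢0⇒∈ : ∀ (p : Poly n) {γ} → coeff p γ ≢ 0ℚ → γ ∈ monomials p
  coeff≢0⇒∈ []            cγ≢0 = contradiction refl cγ≢0
  coeff≢0⇒∈ ((a , β) ∷ p) {γ} cγ≢0 with Vec.≡-dec ℕ._≟_ β γ
  ... | yes β≡γ = here (sym β≡γ)
  ... | no  _   = there (coeff≢0⇒∈ p cγ≢0)

  private
    maximal-nonZero : ∀ p (xs : List (Mon n)) →
      (∀ γ → γ ∈ xs → coeff p γ ≡ 0ℚ) ⊎
      ∃ λ α → coeff p α ≢ 0ℚ × (∀ γ → γ ∈ xs → coeff p γ ≢ 0ℚ → γ ≢ α → γ <ₗₑₓ α)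
    maximal-nonZero p [] = inj₁ (λ _ ())
    maximal-nonZero p (x ∷ xs) with coeff p x ℚ.≟ 0ℚ | maximal-nonZero p xs
    ... | yes cx≡0 | inj₁ xs≡0 = inj₁ λ { γ (here refl) → cx≡0 ; γ (there γ∈xs) → xs≡0 γ γ∈xs }
    ... | yes cx≡0 | inj₂ (α , cα≢0 , below-α) =
      inj₂ (α , cα≢0 , λ { γ (here refl) cγ≢0 → contradiction cx≡0 cγ≢0 ; γ (there γ∈xs) → below-α γ γ∈xs })
    ... | no cx≢0 | inj₁ xs≡0 =
      inj₂ (x , cx≢0 , λ { γ (here refl) _ γ≢x → contradiction refl γ≢x
                         ; γ (there γ∈xs) cγ≢0 → contradiction (xs≡0 γ γ∈xs) cγ≢0 })
    ... | no cx≢0 | inj₂ (α , cα≢0 , below-α) with <ₗₑₓ-cmp x α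
    ...   | tri< x<α _ _ = inj₂ (α , cα≢0 , λ { γ (here refl) _ _ → x<α ; γ (there γ∈xs) → below-α γ γ∈xs })
    ...   | tri≈ _ refl _ = inj₂ (α , cα≢0 , λ { γ (here refl) _ γ≢x → contradiction refl γ≢x ; γ (there γ∈xs) → below-α γ γ∈xs })
    ...   | tri> _ _ α<x = inj₂ (x , cx≢0 , λ { γ (here refl) _ γ≢x → contradiction refl γ≢x
                                              ; γ (there γ∈xs) cγ≢0 _ → below-x γ γ∈xs cγ≢0 })
      where
      below-x : ∀ γ → γ ∈ xs → coeff p γ ≢ 0ℚ → γ <ₗₑₓ x
      below-x γ γ∈xs cγ≢0 with Vec.≡-dec ℕ._≟_ γ α
      ... | yes refl = α<x
      ... | no γ≢α   = <ₗₑₓ-trans (below-α γ γ∈xs cγ≢0 γ≢α) α<x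

  leading : ∀ p → NonZeroP p → ∃ (IsLeading p)
  leading p p≢0 with maximal-nonZero p (monomials p)
  ... | inj₁ p≡0 = contradiction p≈0 p≢0
    where
    p≈0 : ∀ γ → coeff p γ ≡ 0ℚ
    p≈0 γ with coeff p γ ℚ.≟ 0ℚ
    ... | yes cγ≡0 = cγ≡0
    ... | no  cγ≢0 = p≡0 γ (coeff≢0⇒∈ p cγ≢0)
  ... | inj₂ (α , cα≢0 , below-α) = α , cα≢0 , λ γ cγ≢0 → below-α γ (coeff≢0⇒∈ p cγ≢0) cγ≢0

  coeff-*ₚ-leading : ∀ p q {α β} → IsLeading p α → IsLeading q β → coeff (p *ₚ q) (α ⊕ β) ≡ coeff p α *ℚ coeff q β
  coeff-*ₚ-leading p q {α} {β} (_ , below-α) (_ , below-β) = begin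
    coeff (p *ₚ q) (α ⊕ β)                     ≡⟨ coeff-*ₚ p q (α ⊕ β) ⟩
    Σₚ p (λ γ → Σₚ q (λ δ → indicator (α ⊕ β) (γ ⊕ δ)))
      ≡⟨ Σₚ-supported-at p _ α (λ γ cγ≢0 γ≢α → Σₚ-vanishes q _ (λ δ cδ≢0 →
           indicator-≢ (<ₗₑₓ⇒≢ (shifted-below (below-α γ cγ≢0 γ≢α) cδ≢0)))) ⟩
    coeff p α *ℚ Σₚ q (λ δ → indicator (α ⊕ β) (α ⊕ δ))
      ≡⟨ cong (coeff p α *ℚ_) (Σₚ-supported-at q _ β (λ δ cδ≢0 δ≢β →
           indicator-≢ (<ₗₑₓ⇒≢ (⊕-monoʳ-<ₗₑₓ α (below-β δ cδ≢0 δ≢β))))) ⟩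
    coeff p α *ℚ (coeff q β *ℚ indicator (α ⊕ β) (α ⊕ β))
      ≡⟨ cong (λ i → coeff p α *ℚ (coeff q β *ℚ i)) (indicator-≡ (α ⊕ β)) ⟩
    coeff p α *ℚ (coeff q β *ℚ 1ℚ)
      ≡⟨ cong (coeff p α *ℚ_) (ℚ.*-identityʳ (coeff q β)) ⟩
    coeff p α *ℚ coeff q β ∎
    where
    open ≡-Reasoning
    shifted-below : ∀ {γ δ} → γ <ₗₑₓ α → coeff q δ ≢ 0ℚ → γ ⊕ δ <ₗₑₓ α ⊕ β
    shifted-below {γ} {δ} γ<α cδ≢0 with Vec.≡-dec ℕ._≟_ δ β
    ... | yes refl = ⊕-monoˡ-<ₗₑₓ β γ<α
    ... | no  δ≢β  = <ₗₑₓ-trans (⊕-monoˡ-<ₗₑₓ δ γ<α) (⊕-monoʳ-<ₗₑₓ α (below-β δ cδ≢0 δ≢β))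

  *ₚ-nonZero : ∀ {p q} → NonZeroP p → NonZeroP q → NonZeroP (p *ₚ q)
  *ₚ-nonZero {p} {q} p≢0 q≢0 pq≡0 with leading p p≢0 | leading q q≢0
  ... | α , α-leads | β , β-leads =
    *ℚ-nonZero (proj₁ α-leads) (proj₁ β-leads) (trans (sym (coeff-*ₚ-leading p q α-leads β-leads)) (pq≡0 (α ⊕ β)))

*ₚ-almostCancelˡ : ∀ {n} → AlgebraDefinitions.AlmostLeftCancellative (_≈ₚ_ {n}) [] _*ₚ_
*ₚ-almostCancelˡ {n} p q r p≢0 pq≈pr = x∙y⁻¹≈ε⇒x≈y q r q-r≈0
  where
  module R = CommutativeRing (Poly-commutativeRing n)
  open import Algebra.Properties.Ring R.ring using (x[y-z]≈xy-xz)
  open import Algebra.Properties.Group R.+-group using (x∙y⁻¹≈ε⇒x≈y; x≈y⇒x∙y⁻¹≈ε)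
  q-r≈0 : q -ₚ r ≈ₚ []
  q-r≈0 α with coeff (q -ₚ r) α ℚ.≟ 0ℚ
  ... | yes c≡0 = c≡0
  ... | no  c≢0 = contradiction p[q-r]≈0 (*ₚ-nonZero {p = p} {q = q -ₚ r} p≢0 (λ q-r≈0 → c≢0 (q-r≈0 α)))
    where
    p[q-r]≈0 : p *ₚ (q -ₚ r) ≈ₚ []
    p[q-r]≈0 = R.trans {p *ₚ (q -ₚ r)} {p *ₚ q -ₚ p *ₚ r} {[]} (x[y-z]≈xy-xz p q r) (x≈y⇒x∙y⁻¹≈ε {p *ₚ q} {p *ₚ r} pq≈pr)

-- Permuting the variables

module VariableSubstitution {n : ℕ} (π : Fin n → Fin n) (π-involutive : ∀ k → π (π k) ≡ k) where

  φ : Vec ℕ n → Vec ℕ n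
  φ v = tabulate (λ k → lookup v (π k))

  φ-involutive : ∀ u → φ (φ u) ≡ u
  φ-involutive u = trans (Vec.tabulate-cong (λ k → trans (Vec.lookup∘tabulate _ (π k)) (cong (lookup u) (π-involutive k))))
                         (Vec.tabulate∘lookup u)

  φ-+ : ∀ u v → φ (zipWith ℕ._+_ u v) ≡ zipWith ℕ._+_ (φ u) (φ v)
  φ-+ u v = Pointwise-≡⇒≡ (ext λ k → begin
    lookup (φ (zipWith ℕ._+_ u v)) k                 ≡⟨ Vec.lookup∘tabulate _ k ⟩
    lookup (zipWith ℕ._+_ u v) (π k)                 ≡⟨ Vec.lookup-zipWith ℕ._+_ (π k) u v ⟩
    lookup u (π k) ℕ.+ lookup v (π k)                ≡⟨ cong₂ ℕ._+_ (Vec.lookup∘tabulate _ k) (Vec.lookup∘tabulate _ k) ⟨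
    lookup (φ u) k ℕ.+ lookup (φ v) k                ≡⟨ Vec.lookup-zipWith ℕ._+_ k (φ u) (φ v) ⟨
    lookup (zipWith ℕ._+_ (φ u) (φ v)) k             ∎)
    where open ≡-Reasoning

  φ-0 : φ (replicate n 0) ≡ replicate n 0
  φ-0 = Pointwise-≡⇒≡ (ext λ k → trans (Vec.lookup∘tabulate _ k)
                         (trans (Vec.lookup-replicate (π k) 0) (sym (Vec.lookup-replicate k 0))))

  φ̂ : Mon n → Mon n
  φ̂ α = head α ∷ φ (tail α)

  φ̂-involutive : ∀ α → φ̂ (φ̂ α) ≡ α
  φ̂-involutive (a ∷ u) = cong (a ∷_) (φ-involutive u)

  φ̂-⊕ : ∀ γ δ → φ̂ (γ ⊕ δ) ≡ φ̂ γ ⊕ φ̂ δ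
  φ̂-⊕ (a ∷ u) (b ∷ v) = cong (a ℕ.+ b ∷_) (φ-+ u v)

  s : Poly n → Poly n
  s = onX φ

  Σₚ-s : ∀ p F → Σₚ (s p) F ≡ Σₚ p (λ γ → F (φ̂ γ))
  Σₚ-s p F = ∑-map _ p _

  indicator-φ̂ : ∀ α γ → indicator α (φ̂ γ) ≡ indicator (φ̂ α) γ
  indicator-φ̂ α γ with Vec.≡-dec ℕ._≟_ γ (φ̂ α)
  ... | yes γ≡φ̂α = trans (cong (indicator α) (trans (cong φ̂ γ≡φ̂α) (φ̂-involutive α))) (indicator-≡ α)
  ... | no  γ≢φ̂α = indicator-≢ {α = α} {γ = φ̂ γ} (λ φ̂γ≡α → γ≢φ̂α (trans (sym (φ̂-involutive γ)) (cong φ̂ φ̂γ≡α)))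

  coeff-s : ∀ p α → coeff (s p) α ≡ coeff p (φ̂ α)
  coeff-s p α = begin
    coeff (s p) α                          ≡⟨ coeff-Σₚ (s p) α ⟩
    Σₚ (s p) (indicator α)                 ≡⟨ Σₚ-s p _ ⟩
    Σₚ p (λ γ → indicator α (φ̂ γ))         ≡⟨ Σₚ-cong p (indicator-φ̂ α) ⟩
    Σₚ p (indicator (φ̂ α))                 ≡⟨ coeff-Σₚ p (φ̂ α) ⟨
    coeff p (φ̂ α)                          ∎
    where open ≡-Reasoning

  s-cong : ∀ {p q} → p ≈ₚ q → s p ≈ₚ s q
  s-cong {p} {q} p≈q α = trans (coeff-s p α) (trans (p≈q (φ̂ α)) (sym (coeff-s q α)))

  s-+ₚ : ∀ p q → s (p +ₚ q) ≡ s p +ₚ s q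
  s-+ₚ p q = List.map-++ _ p q

  s--ₚ : ∀ p → s (-ₚ p) ≡ -ₚ s p
  s--ₚ []      = refl
  s--ₚ ((a , α) ∷ p) = cong ((-ℚ a , φ̂ α) ∷_) (s--ₚ p)

  s-*ₚ : ∀ p q → s (p *ₚ q) ≈ₚ s p *ₚ s q
  s-*ₚ p q α = begin
    coeff (s (p *ₚ q)) α                                      ≡⟨ coeff-s (p *ₚ q) α ⟩
    coeff (p *ₚ q) (φ̂ α)                                      ≡⟨ coeff-*ₚ p q (φ̂ α) ⟩
    Σₚ p (λ γ → Σₚ q (λ δ → indicator (φ̂ α) (γ ⊕ δ)))         ≡⟨ Σₚ-cong p (λ γ → Σₚ-cong q (λ δ → begin
      indicator (φ̂ α) (γ ⊕ δ)   ≡⟨ indicator-φ̂ α (γ ⊕ δ) ⟨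
      indicator α (φ̂ (γ ⊕ δ))   ≡⟨ cong (indicator α) (φ̂-⊕ γ δ) ⟩
      indicator α (φ̂ γ ⊕ φ̂ δ)   ∎)) ⟩
    Σₚ p (λ γ → Σₚ q (λ δ → indicator α (φ̂ γ ⊕ φ̂ δ)))         ≡⟨ Σₚ-s p _ ⟨
    Σₚ (s p) (λ γ → Σₚ q (λ δ → indicator α (γ ⊕ φ̂ δ)))       ≡⟨ Σₚ-cong (s p) (λ γ → Σₚ-s q _) ⟨
    Σₚ (s p) (λ γ → Σₚ (s q) (λ δ → indicator α (γ ⊕ δ)))     ≡⟨ coeff-*ₚ (s p) (s q) α ⟨
    coeff (s p *ₚ s q) α                                      ∎
    where open ≡-Reasoning

  s-1ₚ : s 1ₚ ≡ 1ₚ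
  s-1ₚ = cong (λ u → (1ℚ , 0 ∷ u) ∷ []) φ-0

  s-involutive : ∀ p → s (s p) ≈ₚ p
  s-involutive p α = trans (coeff-s (s p) α) (trans (coeff-s p (φ̂ α)) (cong (coeff p) (φ̂-involutive α)))

  s-tP : s tP ≈ₚ tP
  s-tP α = cong (λ u → coeff ((1ℚ , 1 ∷ u) ∷ []) α) φ-0

  s-fixes-ℚ[t] : ∀ d → (∀ α → coeff d α ≢ 0ℚ → tail α ≡ replicate n 0) → s d ≈ₚ d
  s-fixes-ℚ[t] d d∈ℚ[t] α = trans (coeff-s d α) (fixed α)
    where
    φ̂-fixes-support : ∀ α → coeff d α ≢ 0ℚ → φ̂ α ≡ α
    φ̂-fixes-support (a ∷ u) cα≢0 = cong (a ∷_) (trans (cong φ (d∈ℚ[t] _ cα≢0)) (trans φ-0 (sym (d∈ℚ[t] _ cα≢0))))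
    fixed : ∀ α → coeff d (φ̂ α) ≡ coeff d α
    fixed α with coeff d (φ̂ α) ℚ.≟ 0ℚ | coeff d α ℚ.≟ 0ℚ
    ... | no cφ̂α≢0 | _        = cong (coeff d) (trans (sym (φ̂-fixes-support _ cφ̂α≢0)) (φ̂-involutive α))
    ... | yes cφ̂α≡0 | yes cα≡0 = trans cφ̂α≡0 (sym cα≡0)
    ... | yes _    | no cα≢0   = cong (coeff d) (φ̂-fixes-support α cα≢0)

  private module R = CommutativeRing (Poly-commutativeRing n)

  s-isRingHomomorphism : RingMorphisms.IsRingHomomorphism R.rawRing R.rawRing s
  s-isRingHomomorphism = record
    { isSemiringHomomorphism = record
      { isNearSemiringHomomorphism = record
        { +-isMonoidHomomorphism = record
          { isMagmaHomomorphism = record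
            { isRelHomomorphism = record { cong = λ {p q} → s-cong {p} {q} }
            ; homo = λ p q → R.reflexive (s-+ₚ p q) }
          ; ε-homo = λ α → refl }
        ; *-homo = s-*ₚ }
      ; 1#-homo = R.reflexive s-1ₚ }
    ; -‿homo = λ p → R.reflexive (s--ₚ p) }

-- Rearrangements of a partition

module _ {m : ℕ} (i j : Fin m) where

  swapFin-i : swapFin i j i ≡ j
  swapFin-i with i ≟ᶠ i
  ... | yes _   = refl
  ... | no  i≢i = contradiction refl i≢i

  swapFin-j : swapFin i j j ≡ i
  swapFin-j with j ≟ᶠ i
  ... | yes j≡i = j≡i
  ... | no  _ with j ≟ᶠ j
  ...   | yes _   = refl
  ...   | no  j≢j = contradiction refl j≢j

  swapFin-other : ∀ {k} → k ≢ i → k ≢ j → swapFin i j k ≡ k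
  swapFin-other {k} k≢i k≢j with k ≟ᶠ i
  ... | yes k≡i = contradiction k≡i k≢i
  ... | no  _ with k ≟ᶠ j
  ...   | yes k≡j = contradiction k≡j k≢j
  ...   | no  _   = refl

  swapFin-involutive : ∀ k → swapFin i j (swapFin i j k) ≡ k
  swapFin-involutive k with k ≟ᶠ i
  ... | yes refl = swapFin-j
  ... | no  k≢i with k ≟ᶠ j
  ...   | yes refl = swapFin-i
  ...   | no  k≢j  = swapFin-other k≢i k≢j

  swapFin≗transpose : ∀ k → swapFin i j k ≡ transpose i j ⟨$⟩ʳ k
  swapFin≗transpose k with k ≟ᶠ i
  ... | yes _ = refl
  ... | no  _ with k ≟ᶠ j
  ...   | yes _ = refl
  ...   | no  _ = refl

  lookup-swapV : ∀ {A : Set} (v : Vec A m) k → lookup (swapV i j v) k ≡ lookup v (swapFin i j k)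
  lookup-swapV v k = Vec.lookup∘tabulate _ k

  swapV-involutive : ∀ {A : Set} (v : Vec A m) → swapV i j (swapV i j v) ≡ v
  swapV-involutive v = Pointwise-≡⇒≡ (ext λ k →
    trans (lookup-swapV (swapV i j v) k) (trans (lookup-swapV v (swapFin i j k)) (cong (lookup v) (swapFin-involutive k))))

  permV-transpose : ∀ {A : Set} (v : Vec A m) → permV (transpose i j) v ≡ swapV i j v
  permV-transpose v = Vec.tabulate-cong (λ k → cong (lookup v) (sym (swapFin≗transpose k)))

  swapV-∈S : ∀ {η lam} → η ∈S lam → swapV i j η ∈S lam
  swapV-∈S {lam = lam} (σ , refl) = transpose i j ∘ₚ σ , Vec.tabulate-cong (λ k → begin
    lookup (permV σ lam) (swapFin i j k)                    ≡⟨ Vec.lookup∘tabulate _ (swapFin i j k) ⟩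
    lookup lam (σ ⟨$⟩ʳ swapFin i j k)                       ≡⟨ cong (λ l → lookup lam (σ ⟨$⟩ʳ l)) (swapFin≗transpose k) ⟩
    lookup lam ((transpose i j ∘ₚ σ) ⟨$⟩ʳ k)                ∎)
    where open ≡-Reasoning

swapFin-suc : ∀ {m} (i j k : Fin m) → swapFin (suc i) (suc j) (suc k) ≡ suc (swapFin i j k)
swapFin-suc i j k with k ≟ᶠ i
... | yes _ = refl
... | no  _ with k ≟ᶠ j
...   | yes _ = refl
...   | no  _ = refl

swapV-suc : ∀ {A : Set} {m} (i j : Fin m) x (xs : Vec A m) → swapV (suc i) (suc j) (x ∷ xs) ≡ x ∷ swapV i j xs
swapV-suc i j x xs = Pointwise-≡⇒≡ (ext λ
  { zero    → trans (lookup-swapV (suc i) (suc j) (x ∷ xs) zero)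
                    (cong (lookup (x ∷ xs)) (swapFin-other (suc i) (suc j) {zero} (λ ()) (λ ())))
  ; (suc k) → trans (lookup-swapV (suc i) (suc j) (x ∷ xs) (suc k))
                    (trans (cong (lookup (x ∷ xs)) (swapFin-suc i j k)) (sym (lookup-swapV i j xs k))) })

swapV-01 : ∀ {A : Set} {m} (a b : A) (r : Vec A m) → swapV zero (suc zero) (a ∷ b ∷ r) ≡ b ∷ a ∷ r
swapV-01 a b r = Pointwise-≡⇒≡ (ext λ
  { zero          → trans (lookup-swapV zero (suc zero) (a ∷ b ∷ r) zero)
                          (cong (lookup (a ∷ b ∷ r)) (swapFin-i zero (suc zero)))
  ; (suc zero)    → trans (lookup-swapV zero (suc zero) (a ∷ b ∷ r) (suc zero))
                          (cong (lookup (a ∷ b ∷ r)) (swapFin-j zero (suc zero)))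
  ; (suc (suc k)) → trans (lookup-swapV zero (suc zero) (a ∷ b ∷ r) (suc (suc k)))
                          (cong (lookup (a ∷ b ∷ r)) (swapFin-other zero (suc zero) {suc (suc k)} (λ ()) (λ ()))) })

-- moment η = Σ_k k·η_k
moment : ∀ {m} → Vec ℕ m → ℕ
moment []       = 0
moment (x ∷ xs) = sum xs ℕ.+ moment xs

sum-swapV : ∀ {m} (η : Vec ℕ m) {i j} → Adj i j → sum (swapV i j η) ≡ sum η
sum-swapV (a ∷ b ∷ r) {zero} {suc zero} refl = begin
  sum (swapV zero (suc zero) (a ∷ b ∷ r)) ≡⟨ cong sum (swapV-01 a b r) ⟩
  b ℕ.+ (a ℕ.+ sum r)                     ≡⟨ ℕ.+-assoc b a (sum r) ⟨
  b ℕ.+ a ℕ.+ sum r                       ≡⟨ cong (ℕ._+ sum r) (ℕ.+-comm b a) ⟩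
  a ℕ.+ b ℕ.+ sum r                       ≡⟨ ℕ.+-assoc a b (sum r) ⟩
  a ℕ.+ (b ℕ.+ sum r)                     ∎
  where open ≡-Reasoning
sum-swapV (x ∷ xs) {suc i} {suc j} adj =
  trans (cong sum (swapV-suc i j x xs)) (cong (x ℕ.+_) (sum-swapV xs (ℕ.suc-injective adj)))

moment-swapV-ascent : ∀ {m} (η : Vec ℕ m) {i j} → Adj i j → lookup η i < lookup η j → moment (swapV i j η) < moment η
moment-swapV-ascent (a ∷ b ∷ r) {zero} {suc zero} refl a<b =
  subst (_< moment (a ∷ b ∷ r)) (cong moment (sym (swapV-01 a b r)))
    (ℕ.+-monoˡ-< (sum r ℕ.+ moment r) (ℕ.+-monoˡ-< (sum r) a<b))
moment-swapV-ascent (x ∷ xs) {suc i} {suc j} adj xsᵢ<xsⱼ =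
  subst (_< moment (x ∷ xs)) (cong moment (sym (swapV-suc i j x xs)))
    (subst (λ σ → σ ℕ.+ moment (swapV i j xs) < sum xs ℕ.+ moment xs) (sym (sum-swapV xs (ℕ.suc-injective adj)))
      (ℕ.+-monoʳ-< (sum xs) (moment-swapV-ascent xs (ℕ.suc-injective adj) xsᵢ<xsⱼ)))

Adj⇒≢ : ∀ {m} {i j : Fin m} → Adj i j → i ≢ j
Adj⇒≢ adj refl = ℕ.1+n≢n (sym adj)

HasAscent : ∀ {m} → Vec ℕ m → Set
HasAscent η = ∃₂ λ i j → Adj i j × lookup η i < lookup η j

ascent-or-partition : ∀ {m} (η : Vec ℕ m) → HasAscent η ⊎ IsPartition η
ascent-or-partition []           = inj₂ (λ ())
ascent-or-partition (x ∷ [])     = inj₂ (λ { zero zero _ → ℕ.≤-refl })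
ascent-or-partition (x ∷ y ∷ ys) with ascent-or-partition (y ∷ ys)
... | inj₁ (i , j , adj , ηᵢ<ηⱼ) = inj₁ (suc i , suc j , cong ℕ.suc adj , ηᵢ<ηⱼ)
... | inj₂ y∷ys↘ with x ℕ.<? y
...   | yes x<y = inj₁ (zero , suc zero , refl , x<y)
...   | no  x≮y = inj₂ λ
  { zero    zero    _         → ℕ.≤-refl
  ; zero    (suc l) _         → ℕ.≤-trans (y∷ys↘ zero l z≤n) (ℕ.≮⇒≥ x≮y)
  ; (suc k) (suc l) (s≤s k≤l) → y∷ys↘ k l k≤l }

pivot : ∀ {m} (σ : Permutation′ m) k → ∃ λ l → l Fin.≤ k × k Fin.≤ σ ⟨$⟩ʳ l
pivot σ = Fin.injective⇒existsPivot (inverseʳ⇒injective (σ ⟨$⟩ʳ_) (Inverse.inverseʳ σ))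

-- Some l ≤ k has σ l ≥ k, so η_k ≤ η_l = λ_{σ l} ≤ λ_k; symmetrically with σ⁻¹.
partition-unique : ∀ {m} {lam η : Vec ℕ m} → IsPartition lam → IsPartition η → η ∈S lam → η ≡ lam
partition-unique {lam = lam} {η} lam↘ η↘ (σ , refl) = Pointwise-≡⇒≡ (ext λ k → ℕ.≤-antisym (η≤lam k) (lam≤η k))
  where
  open ℕ.≤-Reasoning
  lookup-η : ∀ k → lookup η k ≡ lookup lam (σ ⟨$⟩ʳ k)
  lookup-η k = Vec.lookup∘tabulate _ k
  η≤lam : ∀ k → lookup η k ≤ lookup lam k
  η≤lam k with pivot σ k
  ... | l , l≤k , k≤σl = begin
    lookup η k               ≤⟨ η↘ l k l≤k ⟩
    lookup η l               ≡⟨ lookup-η l ⟩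
    lookup lam (σ ⟨$⟩ʳ l)    ≤⟨ lam↘ k (σ ⟨$⟩ʳ l) k≤σl ⟩
    lookup lam k             ∎
  lam≤η : ∀ k → lookup lam k ≤ lookup η k
  lam≤η k with pivot (flip σ) k
  ... | l , l≤k , k≤σ⁻¹l = begin
    lookup lam k                    ≤⟨ lam↘ l k l≤k ⟩
    lookup lam l                    ≡⟨ cong (lookup lam) (inverseʳ σ) ⟨
    lookup lam (σ ⟨$⟩ʳ (σ ⟨$⟩ˡ l))  ≡⟨ lookup-η (σ ⟨$⟩ˡ l) ⟨
    lookup η (σ ⟨$⟩ˡ l)             ≤⟨ η↘ k (σ ⟨$⟩ˡ l) k≤σ⁻¹l ⟩
    lookup η k                      ∎

sorting-induction : ∀ {m} {lam : Vec ℕ m} → IsPartition lam → (P : Vec ℕ m → Set) → P lam →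
  (∀ μ i j → μ ∈S lam → Adj i j → lookup μ j < lookup μ i → P μ → P (swapV i j μ)) →
  ∀ η → η ∈S lam → P η
sorting-induction {lam = lam} lam↘ P P-lam P-step η = go η (On.wellFounded moment <-wellFounded η)
  where
  go : ∀ η → Acc (_<_ on moment) η → η ∈S lam → P η
  go η (acc smaller) η∈S with ascent-or-partition η
  ... | inj₂ η↘ = subst P (sym (partition-unique lam↘ η↘ η∈S)) P-lam
  ... | inj₁ (i , j , adj , ηᵢ<ηⱼ) = subst P (swapV-involutive i j η)
    (P-step μ i j μ∈S adj μⱼ<μᵢ (go μ (smaller (moment-swapV-ascent η adj ηᵢ<ηⱼ)) μ∈S))
    where
    μ : Vec ℕ _
    μ = swapV i j η
    μ∈S : μ ∈S lam
    μ∈S = swapV-∈S i j {lam = lam} η∈S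
    μⱼ<μᵢ : lookup μ j < lookup μ i
    μⱼ<μᵢ = subst₂ _<_ (sym (trans (lookup-swapV i j η j) (cong (lookup η) (swapFin-j i j))))
                      (sym (trans (lookup-swapV i j η i) (cong (lookup η) (swapFin-i i j)))) ηᵢ<ηⱼ

-- The transposition s_i of ℚ[t, x₁, …, xₙ]

unitVec : ∀ {n} → Fin n → Vec ℕ n
unitVec {n} i = replicate n 0 [ i ]≔ 1

lookup-unitVec-≡ : ∀ {n} (i : Fin n) → lookup (unitVec i) i ≡ 1
lookup-unitVec-≡ {n} i = Vec.lookup∘update i (replicate n 0) 1

lookup-unitVec-≢ : ∀ {n} {i k : Fin n} → k ≢ i → lookup (unitVec i) k ≡ 0
lookup-unitVec-≢ {n} {i} {k} k≢i = trans (Vec.lookup∘update′ k≢i (replicate n 0) 1) (Vec.lookup-replicate k 0)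

tP-nonZero : ∀ {n} → NonZeroP (tP {n})
tP-nonZero {n} tP≈0 = ℚ.1≢0 (trans (sym (coeff-monomial 1ℚ (1 ∷ replicate n 0))) (tP≈0 (1 ∷ replicate n 0)))

xP-xP-nonZero : ∀ {n} {i j : Fin n} → i ≢ j → NonZeroP (xP i -ₚ xP j)
xP-xP-nonZero {n} {i} {j} i≢j xᵢ-xⱼ≈0 = ℚ.1≢0 (trans (sym coeff-at-xᵢ) (xᵢ-xⱼ≈0 (0 ∷ unitVec i)))
  where
  eⱼ≢eᵢ : unitVec j ≢ unitVec i
  eⱼ≢eᵢ eⱼ≡eᵢ = ℕ.1+n≢0 (trans (sym (lookup-unitVec-≡ j))
                               (trans (cong (λ e → lookup e j) eⱼ≡eᵢ) (lookup-unitVec-≢ (≢-sym i≢j))))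
  coeff-at-xᵢ : coeff (xP i -ₚ xP j) (0 ∷ unitVec i) ≡ 1ℚ
  coeff-at-xᵢ = begin
    coeff (xP i -ₚ xP j) (0 ∷ unitVec i)
      ≡⟨ coeff-∷ 1ℚ (0 ∷ unitVec i) (-ₚ xP j) (0 ∷ unitVec i) ⟩
    1ℚ *ℚ indicator (0 ∷ unitVec i) (0 ∷ unitVec i) +ℚ coeff (-ₚ xP j) (0 ∷ unitVec i)
      ≡⟨ cong₂ _+ℚ_ (cong (1ℚ *ℚ_) (indicator-≡ (0 ∷ unitVec i))) (coeff-∷ (-ℚ 1ℚ) (0 ∷ unitVec j) [] (0 ∷ unitVec i)) ⟩
    1ℚ *ℚ 1ℚ +ℚ (-ℚ 1ℚ *ℚ indicator (0 ∷ unitVec i) (0 ∷ unitVec j) +ℚ 0ℚ)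
      ≡⟨ cong (λ δ → 1ℚ *ℚ 1ℚ +ℚ (-ℚ 1ℚ *ℚ δ +ℚ 0ℚ))
              (indicator-≢ {α = 0 ∷ unitVec i} {γ = 0 ∷ unitVec j} (λ eq → eⱼ≢eᵢ (cong tail eq))) ⟩
    1ℚ *ℚ 1ℚ +ℚ (-ℚ 1ℚ *ℚ 0ℚ +ℚ 0ℚ)
      ≡⟨⟩
    1ℚ ∎
    where open ≡-Reasoning

module Transposition {n : ℕ} (i j : Fin n) where

  open VariableSubstitution (swapFin i j) (swapFin-involutive i j) public

  swapV-unitVec : swapV i j (unitVec i) ≡ unitVec j
  swapV-unitVec = Pointwise-≡⇒≡ (ext λ k → trans (lookup-swapV i j (unitVec i) k) (lemma k))
    where
    lemma : ∀ k → lookup (unitVec i) (swapFin i j k) ≡ lookup (unitVec j) k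
    lemma k with k ≟ᶠ j
    ... | yes refl = trans (cong (lookup (unitVec i)) (swapFin-j i k)) (trans (lookup-unitVec-≡ i) (sym (lookup-unitVec-≡ k)))
    ... | no  k≢j  = trans (lookup-unitVec-≢ sk≢i) (sym (lookup-unitVec-≢ k≢j))
      where
      sk≢i : swapFin i j k ≢ i
      sk≢i sk≡i = k≢j (trans (sym (swapFin-involutive i j k)) (trans (cong (swapFin i j) sk≡i) (swapFin-i i j)))

  s-xPᵢ : s (xP i) ≈ₚ xP j
  s-xPᵢ α = cong (λ u → coeff ((1ℚ , 0 ∷ u) ∷ []) α) swapV-unitVec

  symmetric⇒s-invariant : ∀ N D → SymRat N D → s N *ₚ D ≈ₚ N *ₚ s D
  symmetric⇒s-invariant N D N/D-symmetric =
    subst₂ (λ sN sD → sN *ₚ D ≈ₚ N *ₚ sD) (onX-transpose N) (onX-transpose D) (N/D-symmetric (transpose i j))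
    where
    onX-transpose : ∀ p → onX (permV (transpose i j)) p ≡ s p
    onX-transpose = List.map-cong (λ (a , α) → cong (λ u → (a , head α ∷ u)) (permV-transpose i j (tail α)))

  heckeSetting : i ≢ j → HeckeSetting (Poly-commutativeRing n)
  heckeSetting i≢j = record
    { *-almostCancelˡ      = *ₚ-almostCancelˡ
    ; s                    = s
    ; s-isRingHomomorphism = s-isRingHomomorphism
    ; s-involutive         = s-involutive
    ; t                    = tP
    ; x                    = xP i
    ; y                    = xP j
    ; s-t                  = s-tP
    ; s-x                  = s-xPᵢ
    ; t≉0                  = tP-nonZero
    ; x-y≉0                = xP-xP-nonZero i≢j
    }

  module _ (i≢j : i ≢ j) where

    open HeckeOperator (heckeSetting i≢j)

    T-nonZero : ∀ (f f′ : Frac n) → NonZeroF f → TRel i j f f′ → NonZeroF f′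
    T-nonZero f f′ f≢0 Tf≡f′ = Hecke-nonZero {num f} {den f} {num f′} {den f′} (den-nz f′) f≢0 Tf≡f′

    T-invariant-multiple : ∀ (f f′ g g′ : Frac n) (N D : Poly n) → NonZeroP D → s N *ₚ D ≈ₚ N *ₚ s D →
      EqRat (ratioN g f) (ratioD g f) N D → TRel i j f f′ → TRel i j g g′ →
      EqRat (ratioN g′ f′) (ratioD g′ f′) N D
    T-invariant-multiple f f′ g g′ N D D≢0 N/D-invariant g≈hf Tf≡f′ Tg≡g′ =
      Hecke-invariant-multiple {num f} {den f} {num f′} {den f′} {num g} {den g} {num g′} {den g′} {N} {D}
        (den-nz f) (den-nz g) D≢0 (s-fixes-ℚ[t] (den f) (den-t f)) (s-fixes-ℚ[t] (den g) (den-t g))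
        N/D-invariant g≈hf Tf≡f′ Tg≡g′

lemma4p13 : (n : ℕ) (lam : Vec ℕ n) → IsPartition lam →
    (f g : Vec ℕ n → Frac n) → KZFamily lam f → KZFamily lam g →
    NonZeroF (f lam) →
    SymRat (ratioN (g lam) (f lam)) (ratioD (g lam) (f lam)) →
    ∀ η → η ∈S lam →
      NonZeroF (f η) ×
      EqRat (ratioN (g η) (f η)) (ratioD (g η) (f η)) (ratioN (g lam) (f lam)) (ratioD (g lam) (f lam))
lemma4p13 n lam lam↘ f g f-KZ g-KZ f-lam≢0 h-symmetric = sorting-induction lam↘ g/f≈h (f-lam≢0 , λ α → refl) T-step
  where
  N = ratioN (g lam) (f lam)
  D = ratioD (g lam) (f lam)
  g/f≈h : Vec ℕ n → Set
  g/f≈h η = NonZeroF (f η) × EqRat (ratioN (g η) (f η)) (ratioD (g η) (f η)) N D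
  T-step : ∀ μ i j → μ ∈S lam → Adj i j → lookup μ j < lookup μ i → g/f≈h μ → g/f≈h (swapV i j μ)
  T-step μ i j μ∈S adj μⱼ<μᵢ (fμ≢0 , gμ≈hfμ) =
      T-nonZero i≢j (f μ) (f η) fμ≢0 Tfμ≡fη
    , T-invariant-multiple i≢j (f μ) (f η) (g μ) (g η) N D D≢0 (symmetric⇒s-invariant N D h-symmetric)
        gμ≈hfμ Tfμ≡fη Tgμ≡gη
    where
    open Transposition i j
    i≢j = Adj⇒≢ adj
    η = swapV i j μ
    D≢0 = *ₚ-nonZero {p = num (f lam)} {q = den (g lam)} f-lam≢0 (den-nz (g lam))
    Tfμ≡fη = KZFamily.T-gt f-KZ μ μ∈S i j adj μⱼ<μᵢ
    Tgμ≡gη = KZFamily.T-gt g-KZ μ μ∈S i j adj μⱼ<μᵢ
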